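{- Let $k \ge 2$ be an integer and let $I=[x';x'']$ be an integer interval with $|I|\ge 8k-5$ and $|I|$ odd. Then the knight graph on $U(k,I)$ is a cycle.
   Context: Knight graph on $S\subseteq\mathbb{Z}^2$: cells adjacent iff $\{|x'-x''|,|y'-y''|\}=\{1,2\}$. A twine is a set of cells $[u;v]\times[y;y+1]$ (a board of height $2$); its lower left corner is $(u,y)$ and lower right corner is $(v,y)$. To tie off on the left a twine with lower left corner $a$, add the cells $a+\{(-2,1),(-1,1),(-1,3),(0,3)\}$; to tie off on the right a twine with lower right corner $a$, add $a+\{(2,1),(1,1),(1,3),(0,3)\}$. For twines $E,F$ with lower left corners $a,b$ satisfying $a+(1,4)=b$, to splice them together on the left, add $a+\{(-3,4),(-3,5),(-2,2),(-2,3),(-2,6),(-1,1),(-1,2),(-1,6),(0,5),(0,6)\}$; for twines $E,F$ with lower right corners $a,b$ satisfying $a+(-1,4)=b$, to splice them together on the right, add $a+\{(3,4),(3,5),(2,2),(2,3),(2,6),(1,1),(1,2),(1,6),(0,5),(0,6)\}$. For $0\le i\le k-1$ let $E_i=[x'+4i;x''-4i]\times[4i;4i+1]$ if $i$ is even and $E_i=[x'+4i+3;x''-4i+3]\times[4i;4i+1]$ if $i$ is odd. $U(k,I)$ is the union of $E_0,\dots,E_{k-1}$ together with the following added cells: tie off $E_0$ on the left; for $0\le i\le k-2$ splice $E_i$ and $E_{i+1}$ together on the right if $i$ is even and on the left if $i$ is odd; tie off $E_{k-1}$ on the left if $k$ is even and on the right if $k$ is odd. -}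

module Defs where

open import Data.Nat as ℕ using (ℕ; zero; suc)
open import Data.Bool using (Bool; true; false; if_then_else_)
open import Data.Integer as ℤ using (ℤ; +_; -_; ∣_∣)
open import Data.Product using (Σ; ∃; _×_; _,_)
open import Data.Sum using (_⊎_)
open import Data.List using (List; []; _∷_)
open import Data.List.Membership.Propositional using (_∈_)
open import Data.Fin using (Fin; toℕ)
open import Function.Bundles using (_⇔_)
open import Function.Definitions using (Injective)
open import Relation.Binary.PropositionalEquality using (_≡_)

Cell : Set
Cell = ℤ × ℤ

_⊕_ : Cell → Cell → Cell
(a , b) ⊕ (c , d) = (a ℤ.+ c , b ℤ.+ d)

Knight : Cell → Cell → Set
Knight (x₁ , y₁) (x₂ , y₂) =
  (∣ x₁ ℤ.- x₂ ∣ ≡ 1 × ∣ y₁ ℤ.- y₂ ∣ ≡ 2) ⊎ (∣ x₁ ℤ.- x₂ ∣ ≡ 2 × ∣ y₁ ℤ.- y₂ ∣ ≡ 1)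

CellSet : Set₁
CellSet = Cell → Set

InTranslate : Cell → List Cell → Cell → Set
InTranslate a D c = ∃ λ d → d ∈ D × c ≡ a ⊕ d

InTwine : ℤ → ℤ → ℤ → Cell → Set
InTwine u v y (cx , cy) = (u ℤ.≤ cx × cx ℤ.≤ v) × (y ℤ.≤ cy × cy ℤ.≤ y ℤ.+ + 1)

private
  p : ℕ → ℤ
  p n = + n
  m : ℕ → ℤ
  m n = - (+ n)

tieLeftOffsets : List Cell
tieLeftOffsets = (m 2 , p 1) ∷ (m 1 , p 1) ∷ (m 1 , p 3) ∷ (p 0 , p 3) ∷ []

tieRightOffsets : List Cell
tieRightOffsets = (p 2 , p 1) ∷ (p 1 , p 1) ∷ (p 1 , p 3) ∷ (p 0 , p 3) ∷ []

spliceLeftOffsets : List Cell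
spliceLeftOffsets =
  (m 3 , p 4) ∷ (m 3 , p 5) ∷ (m 2 , p 2) ∷ (m 2 , p 3) ∷ (m 2 , p 6) ∷
  (m 1 , p 1) ∷ (m 1 , p 2) ∷ (m 1 , p 6) ∷ (p 0 , p 5) ∷ (p 0 , p 6) ∷ []

spliceRightOffsets : List Cell
spliceRightOffsets =
  (p 3 , p 4) ∷ (p 3 , p 5) ∷ (p 2 , p 2) ∷ (p 2 , p 3) ∷ (p 2 , p 6) ∷
  (p 1 , p 1) ∷ (p 1 , p 2) ∷ (p 1 , p 6) ∷ (p 0 , p 5) ∷ (p 0 , p 6) ∷ []

isEven : ℕ → Bool
isEven zero = true
isEven (suc zero) = false
isEven (suc (suc n)) = isEven n

leftX : ℤ → ℕ → ℤ
leftX x' i = if isEven i then x' ℤ.+ + (4 ℕ.* i) else x' ℤ.+ + (4 ℕ.* i) ℤ.+ + 3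

rightX : ℤ → ℕ → ℤ
rightX x'' i = if isEven i then x'' ℤ.- + (4 ℕ.* i) else x'' ℤ.- + (4 ℕ.* i) ℤ.+ + 3

baseY : ℕ → ℤ
baseY i = + (4 ℕ.* i)

lowerLeft : ℤ → ℕ → Cell
lowerLeft x' i = (leftX x' i , baseY i)

lowerRight : ℤ → ℕ → Cell
lowerRight x'' i = (rightX x'' i , baseY i)

InE : ℤ → ℤ → ℕ → Cell → Set
InE x' x'' i = InTwine (leftX x' i) (rightX x'' i) (baseY i)

InU : ℕ → ℤ → ℤ → CellSet
InU k x' x'' c =
    (∃ λ i → i ℕ.< k × InE x' x'' i c)
  ⊎ InTranslate (lowerLeft x' 0) tieLeftOffsets c
  ⊎ (∃ λ i → suc i ℕ.< k ×
       ((isEven i ≡ true × InTranslate (lowerRight x'' i) spliceRightOffsets c)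
      ⊎ (isEven i ≡ false × InTranslate (lowerLeft x' i) spliceLeftOffsets c)))
  ⊎ ((isEven k ≡ true × InTranslate (lowerLeft x' (k ℕ.∸ 1)) tieLeftOffsets c)
   ⊎ (isEven k ≡ false × InTranslate (lowerRight x'' (k ℕ.∸ 1)) tieRightOffsets c))

CycNext : (n : ℕ) → Fin n → Fin n → Set
CycNext n i j = suc (toℕ i) ≡ toℕ j ⊎ (suc (toℕ i) ≡ n × toℕ j ≡ 0)

-- The knight graph on S is a cycle: S is finite with n ≥ 3 elements, enumerated
-- bijectively by f : Fin n → Cell, and f i, f j are knight-adjacent iff i, j are
-- consecutive modulo n (i.e. the graph is isomorphic to C_n).
KnightGraphIsCycle : CellSet → Set
KnightGraphIsCycle S =
  Σ ℕ λ n → 3 ℕ.≤ n × Σ (Fin n → Cell) λ f →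
      Injective _≡_ _≡_ f
    × (∀ c → S c ⇔ (∃ λ i → f i ≡ c))
    × (∀ i j → Knight (f i) (f j) ⇔ (CycNext n i j ⊎ CycNext n j i))

-- U(k, I) is built from the top twine down. In a frame where a twine of half-width h is [0, 2h] × [0, 1], its cells
-- split into four zigzag runs (by the parity of x and the row at x ∈ {0, 1}), each an induced knight path. A level is
-- an induced path from (1, 0) to (0, 1) through the twine, the splice to the twine above and, mirrored and lifted by
-- four rows, the level above it; the top level turns through its tie-off instead, and the bottom level is
-- closed into an induced cycle by the left tie-off. Non-adjacency between the pieces of a level is reduced to a gap
-- of three in one coordinate between zones whose corners are fixed offsets from either end of the twine, so finitely
-- many evaluated checks cover all widths at once. The parity of |I| decides where the path turns at the ends of each
-- twine, and |I| ≥ 8k − 5 leaves the top twine a positive half-width. Placing the frames on the twines E_j, the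
-- cells of the cycle are exactly those of U(k, I).

module Submission where

module KnightCycle where

  open import Data.Bool using (Bool; true; false; _∧_; _∨_; not; T; _xor_)
  open import Data.Bool.ListAction using (all; any)
  import Data.Bool.Properties as BP
  open import Data.Empty using (⊥; ⊥-elim)
  open import Data.Fin as Fin using (Fin; toℕ)
  open import Data.Integer as ℤ using (ℤ; +_; -_; ∣_∣; _+_; _-_; _≤_; _≤ᵇ_)
  open import Data.Integer.Base using (+≤+)
  open import Data.Integer.Divisibility using (_∣_)
  import Data.Integer.Properties as ℤP
  open import Data.Integer.Tactic.RingSolver using (solve-∀)
  open import Data.List using (List; []; _∷_; _++_; reverse; map; length; lookup; applyUpTo)
  open import Data.List.Membership.Propositional using (_∈_; _∉_; find; lose)
  open import Data.List.Membership.Propositional.Properties using (∈-++⁺ˡ; ∈-++⁺ʳ; ∈-++⁻; ∈-applyUpTo⁻; ∈-applyUpTo⁺; ∈-map⁺; ∈-map⁻; ∈-lookup)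
  open import Data.List.Properties using (unfold-reverse; length-map)
  open import Data.List.Relation.Unary.All as All using (All)
  import Data.List.Relation.Unary.All.Properties as AllP
  open import Data.List.Relation.Unary.Any as Any using (Any; here; there)
  import Data.List.Relation.Unary.Any.Properties as AnyP
  open import Data.Maybe using (Maybe; just; nothing)
  open import Data.Product.Properties using (≡-dec)
  open import Data.Nat as ℕ using (ℕ; zero; suc; z≤n; s≤s; _<_; _∸_)
  open import Data.Nat.Divisibility.Core using (divides)
  import Data.Nat.Properties as NP
  import Data.Nat.Tactic.RingSolver as NS
  open import Data.Product using (∃; ∃₂; _×_; _,_; proj₁; proj₂)
  open import Data.Sum as Sum using (_⊎_; inj₁; inj₂)
  open import Data.Unit using (⊤; tt)
  open import Function.Base using (_∘_; id; case_of_)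
  open import Function.Bundles using (_⇔_; mk⇔; Equivalence)
  open import Function.Properties.Equivalence using () renaming (trans to ⇔-trans)
  open import Function.Definitions using (Injective)
  open import Relation.Binary.PropositionalEquality hiding (J; [_])
  open import Relation.Binary.Definitions using (DecidableEquality)
  open import Relation.Nullary using (¬_; yes; no; Dec)
  open import Relation.Nullary.Decidable as Dec using (⌊_⌋; _×-dec_; _⊎-dec_; toWitness; toWitnessFalse)
  open import Defs

  -- Induced paths and cycles in the knight graph

  knight-resp-∣Δ∣ : ∀ {a b a′ b′} → ∣ proj₁ a′ - proj₁ b′ ∣ ≡ ∣ proj₁ a - proj₁ b ∣ →
                    ∣ proj₂ a′ - proj₂ b′ ∣ ≡ ∣ proj₂ a - proj₂ b ∣ → Knight a b → Knight a′ b′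
  knight-resp-∣Δ∣ ex ey = Sum.map (λ (p , q) → trans ex p , trans ey q) (λ (p , q) → trans ex p , trans ey q)

  knight-sym : ∀ {a b} → Knight a b → Knight b a
  knight-sym {a} {b} = knight-resp-∣Δ∣ {a} {b} {b} {a} (ℤP.∣i-j∣≡∣j-i∣ (proj₁ b) (proj₁ a)) (ℤP.∣i-j∣≡∣j-i∣ (proj₂ b) (proj₂ a))

  knight-irrefl : ∀ {a} → ¬ Knight a a
  knight-irrefl {x , y} (inj₁ (p , _)) = NP.0≢1+n (trans (sym (cong ∣_∣ (ℤP.+-inverseʳ x))) p)
  knight-irrefl {x , y} (inj₂ (_ , q)) = NP.0≢1+n (trans (sym (cong ∣_∣ (ℤP.+-inverseʳ y))) q)

  -- The knight graph induced on the cells of l is exactly the path a — … — b in list order: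
  -- each cell is adjacent to its successor and to no later cell.
  data InducedPath : Cell → Cell → List Cell → Set where
    single : ∀ x → InducedPath x x (x ∷ [])
    step   : ∀ {x y b l} → Knight x y → x ∉ l → (∀ {z} → z ∈ l → Knight x z → z ≡ y) →
             InducedPath y b l → InducedPath x b (x ∷ l)

  last∈ : ∀ {a b l} → InducedPath a b l → b ∈ l
  last∈ (single x)     = here refl
  last∈ (step _ _ _ p) = there (last∈ p)

  starts-with : ∀ {a b l} → InducedPath a b l → ∃ λ l′ → l ≡ a ∷ l′
  starts-with (single x)              = [] , refl
  starts-with (step {l = l} _ _ _ _) = l , refl

  LinkedOnlyAt : Cell → Cell → List Cell → List Cell → Set
  LinkedOnlyAt b c l m = ∀ {u v} → u ∈ l → v ∈ m → u ≢ v × (Knight u v → u ≡ b × v ≡ c)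

  join : ∀ {a b c d l m} → InducedPath a b l → InducedPath c d m → LinkedOnlyAt b c l m →
         Knight b c → InducedPath a d (l ++ m)
  join (single x) q link k =
    step k (λ x∈m → proj₁ (link (here refl) x∈m) refl) (λ z∈m kz → proj₂ (proj₂ (link (here refl) z∈m) kz)) q
  join {m = m} (step {x} {y} {_} {l} kxy x∉l only p) q link k =
    step kxy x∉l++m only′ (join p q (link ∘ there) k)
    where
    x∉l++m : x ∉ l ++ m
    x∉l++m x∈ with ∈-++⁻ l x∈
    ... | inj₁ x∈l = x∉l x∈l
    ... | inj₂ x∈m = proj₁ (link (here refl) x∈m) refl
    only′ : ∀ {z} → z ∈ l ++ m → Knight x z → z ≡ y
    only′ z∈ kz with ∈-++⁻ l z∈
    ... | inj₁ z∈l = only z∈l kz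
    ... | inj₂ z∈m = ⊥-elim (x∉l (subst (_∈ l) (sym (proj₁ (proj₂ (link (here refl) z∈m) kz))) (last∈ p)))

  reverse-path : ∀ {a b l} → InducedPath a b l → InducedPath b a (reverse l)
  reverse-path (single x) = single x
  reverse-path (step {x} {y} {b} {l} kxy x∉l only p) =
    subst (InducedPath b x) (sym (unfold-reverse x l)) (join (reverse-path p) (single x) link (knight-sym {x} {y} kxy))
    where
    link : LinkedOnlyAt y x (reverse l) (x ∷ [])
    link {u} u∈ (here refl) =
      (λ u≡x → x∉l (subst (_∈ l) u≡x (AnyP.reverse⁻ u∈))) ,
      (λ k → only (AnyP.reverse⁻ u∈) (knight-sym {u} {x} k) , refl)

  record KnightIsometry (g : Cell → Cell) : Set where
    field
      injective : ∀ {a b} → g a ≡ g b → a ≡ b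
      preserves : ∀ {a b} → Knight a b → Knight (g a) (g b)
      reflects  : ∀ {a b} → Knight (g a) (g b) → Knight a b

  ∣Δ∣-preserving⇒isometry : ∀ {g : Cell → Cell} → (∀ {a b} → g a ≡ g b → a ≡ b) →
    (∀ a b → ∣ proj₁ (g a) - proj₁ (g b) ∣ ≡ ∣ proj₁ a - proj₁ b ∣) →
    (∀ a b → ∣ proj₂ (g a) - proj₂ (g b) ∣ ≡ ∣ proj₂ a - proj₂ b ∣) → KnightIsometry g
  ∣Δ∣-preserving⇒isometry {g} inj ex ey = record
    { injective = inj
    ; preserves = λ {a} {b} → knight-resp-∣Δ∣ {a} {b} {g a} {g b} (ex a b) (ey a b)
    ; reflects  = λ {a} {b} → knight-resp-∣Δ∣ {g a} {g b} {a} {b} (sym (ex a b)) (sym (ey a b))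
    }

  +-cancelˡ : ∀ i {j k} → i + j ≡ i + k → j ≡ k
  +-cancelˡ i {j} {k} e = trans (sym (-i+[i+j]≡j i j)) (trans (cong (λ z → - i + z) e) (-i+[i+j]≡j i k))
    where
    -i+[i+j]≡j : ∀ i j → - i + (i + j) ≡ j
    -i+[i+j]≡j = solve-∀

  shift : ℤ → Cell → Cell
  shift R (a , y) = (R + a , y)

  shift-isometry : ∀ R → KnightIsometry (shift R)
  shift-isometry R = ∣Δ∣-preserving⇒isometry
    (λ e → cong₂ _,_ (+-cancelˡ R (cong proj₁ e)) (cong proj₂ e))
    (λ (a , _) (a′ , _) → cong ∣_∣ (R+a-[R+a′]≡a-a′ R a a′)) (λ _ _ → refl)
    where
    R+a-[R+a′]≡a-a′ : ∀ R a a′ → (R + a) - (R + a′) ≡ a - a′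
    R+a-[R+a′]≡a-a′ = solve-∀

  module _ {g : Cell → Cell} (iso : KnightIsometry g) where
    open KnightIsometry iso

    ∉-map : ∀ {x l} → x ∉ l → g x ∉ map g l
    ∉-map x∉l gx∈ with ∈-map⁻ g gx∈
    ... | z , z∈ , gx≡gz = x∉l (subst (_∈ _) (sym (injective gx≡gz)) z∈)

    map-path : ∀ {a b l} → InducedPath a b l → InducedPath (g a) (g b) (map g l)
    map-path (single x) = single (g x)
    map-path (step {x} {y} {b} {l} kxy x∉l only p) = step (preserves kxy) (∉-map x∉l) only′ (map-path p)
      where
      only′ : ∀ {z} → z ∈ map g l → Knight (g x) z → z ≡ g y
      only′ z∈ k with ∈-map⁻ g z∈
      ... | z , z∈l , refl = cong g (only z∈l (reflects k))

  lookup-injective : ∀ {a b l} → InducedPath a b l → Injective _≡_ _≡_ (lookup l)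
  lookup-injective (single x)        {Fin.zero}  {Fin.zero}  _ = refl
  lookup-injective (step _ _ _ _)    {Fin.zero}  {Fin.zero}  _ = refl
  lookup-injective (step _ x∉ _ _)   {Fin.zero}  {Fin.suc j} e = ⊥-elim (x∉ (subst (_∈ _) (sym e) (∈-lookup j)))
  lookup-injective (step _ x∉ _ _)   {Fin.suc i} {Fin.zero}  e = ⊥-elim (x∉ (subst (_∈ _) e (∈-lookup i)))
  lookup-injective (step _ _ _ p)    {Fin.suc i} {Fin.suc j} e = cong Fin.suc (lookup-injective p e)

  lookup≡head : ∀ {a b l} → InducedPath a b l → ∀ i → lookup l i ≡ a → toℕ i ≡ 0
  lookup≡head (single x)       Fin.zero    _ = refl
  lookup≡head (step _ _ _ _)   Fin.zero    _ = refl
  lookup≡head (step _ x∉ _ _)  (Fin.suc i) e = ⊥-elim (x∉ (subst (_∈ _) e (∈-lookup i)))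

  lookup≡last : ∀ {a b l} → InducedPath a b l → ∀ i → lookup l i ≡ b → suc (toℕ i) ≡ length l
  lookup≡last (single x)       Fin.zero    _ = refl
  lookup≡last (step _ x∉ _ p)  Fin.zero    e = ⊥-elim (x∉ (subst (_∈ _) (sym e) (last∈ p)))
  lookup≡last (step _ _ _ p)   (Fin.suc i) e = cong suc (lookup≡last p i e)

  lookup-last : ∀ {a b l} → InducedPath a b l → ∀ i → suc (toℕ i) ≡ length l → lookup l i ≡ b
  lookup-last (single x)      Fin.zero    _ = refl
  lookup-last (step _ _ _ p)  Fin.zero    e with starts-with p
  lookup-last (step _ _ _ p)  Fin.zero    () | _ , refl
  lookup-last (step _ _ _ p)  (Fin.suc i) e = lookup-last p i (NP.suc-injective e)

  Consecutive : ∀ {n} → Fin n → Fin n → Set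
  Consecutive i j = suc (toℕ i) ≡ toℕ j ⊎ suc (toℕ j) ≡ toℕ i

  knight⇒consecutive : ∀ {a b l} → InducedPath a b l → ∀ i j → Knight (lookup l i) (lookup l j) → Consecutive i j
  knight⇒consecutive (single x)     Fin.zero Fin.zero k = ⊥-elim (knight-irrefl {x} k)
  knight⇒consecutive (step {x} _ _ _ _) Fin.zero Fin.zero k = ⊥-elim (knight-irrefl {x} k)
  knight⇒consecutive (step _ _ only p) Fin.zero (Fin.suc j) k =
    inj₁ (cong suc (sym (lookup≡head p j (only (∈-lookup j) k))))
  knight⇒consecutive (step {x} {l = l} _ _ only p) (Fin.suc i) Fin.zero k =
    inj₂ (cong suc (sym (lookup≡head p i (only (∈-lookup i) (knight-sym {lookup l i} {x} k)))))
  knight⇒consecutive (step _ _ _ p) (Fin.suc i) (Fin.suc j) k =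
    Sum.map (cong suc) (cong suc) (knight⇒consecutive p i j k)

  consecutive⇒knight : ∀ {a b l} → InducedPath a b l → ∀ i j → suc (toℕ i) ≡ toℕ j → Knight (lookup l i) (lookup l j)
  consecutive⇒knight (single x)     Fin.zero    Fin.zero    ()
  consecutive⇒knight (step _ _ _ _) Fin.zero    Fin.zero    ()
  consecutive⇒knight (step kxy _ _ p) Fin.zero (Fin.suc j) e with starts-with p
  ... | _ , refl with j | e
  ... | Fin.zero  | _  = kxy
  ... | Fin.suc _ | ()
  consecutive⇒knight (step _ _ _ _) (Fin.suc i) Fin.zero    ()
  consecutive⇒knight (step _ _ _ p) (Fin.suc i) (Fin.suc j) e = consecutive⇒knight p i j (NP.suc-injective e)

  -- The cycle a — c — … — b — a, where l lists c … b.
  record InducedCycle (a c b : Cell) (l : List Cell) : Set where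
    field
      path          : InducedPath c b l
      apex-first    : Knight a c
      apex-last     : Knight a b
      apex∉         : a ∉ l
      apex-only     : ∀ {z} → z ∈ l → Knight a z → z ≡ c ⊎ z ≡ b
      length≥2      : 2 ℕ.≤ length l

  module _ {a c b l} (C : InducedCycle a c b l) where
    open InducedCycle C
    private
      n = suc (length l)

    cycle-injective : Injective _≡_ _≡_ (lookup (a ∷ l))
    cycle-injective {Fin.zero}  {Fin.zero}  _ = refl
    cycle-injective {Fin.zero}  {Fin.suc j} e = ⊥-elim (apex∉ (subst (_∈ l) (sym e) (∈-lookup j)))
    cycle-injective {Fin.suc i} {Fin.zero}  e = ⊥-elim (apex∉ (subst (_∈ l) e (∈-lookup i)))
    cycle-injective {Fin.suc i} {Fin.suc j} e = cong Fin.suc (lookup-injective path e)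

    apex-knight⁺ : ∀ j → Knight a (lookup l j) → CycNext n Fin.zero (Fin.suc j) ⊎ CycNext n (Fin.suc j) Fin.zero
    apex-knight⁺ j k with apex-only (∈-lookup j) k
    ... | inj₁ e = inj₁ (inj₁ (cong suc (sym (lookup≡head path j e))))
    ... | inj₂ e = inj₂ (inj₂ (cong suc (lookup≡last path j e) , refl))

    apex-knight⁻ : ∀ j → CycNext n Fin.zero (Fin.suc j) ⊎ CycNext n (Fin.suc j) Fin.zero → Knight a (lookup l j)
    apex-knight⁻ j (inj₁ (inj₁ e)) with starts-with path
    ... | _ , refl with j | e
    ... | Fin.zero  | _  = apex-first
    ... | Fin.suc _ | ()
    apex-knight⁻ j (inj₁ (inj₂ (_ , ())))
    apex-knight⁻ j (inj₂ (inj₁ ()))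
    apex-knight⁻ j (inj₂ (inj₂ (e , _))) = subst (Knight a) (sym (lookup-last path j (NP.suc-injective e))) apex-last

    inner-knight⇔ : ∀ i j → Knight (lookup l i) (lookup l j) ⇔
                    (CycNext n (Fin.suc i) (Fin.suc j) ⊎ CycNext n (Fin.suc j) (Fin.suc i))
    inner-knight⇔ i j = mk⇔ to from
      where
      to : Knight (lookup l i) (lookup l j) → CycNext n (Fin.suc i) (Fin.suc j) ⊎ CycNext n (Fin.suc j) (Fin.suc i)
      to k = Sum.map (inj₁ ∘ cong suc) (inj₁ ∘ cong suc) (knight⇒consecutive path i j k)
      from : CycNext n (Fin.suc i) (Fin.suc j) ⊎ CycNext n (Fin.suc j) (Fin.suc i) → Knight (lookup l i) (lookup l j)
      from (inj₁ (inj₁ e)) = consecutive⇒knight path i j (NP.suc-injective e)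
      from (inj₂ (inj₁ e)) = knight-sym {lookup l j} {lookup l i} (consecutive⇒knight path j i (NP.suc-injective e))
      from (inj₁ (inj₂ (_ , ())))
      from (inj₂ (inj₂ (_ , ())))

    cycle-knight⇔ : ∀ i j → Knight (lookup (a ∷ l) i) (lookup (a ∷ l) j) ⇔ (CycNext n i j ⊎ CycNext n j i)
    cycle-knight⇔ Fin.zero Fin.zero = mk⇔ (⊥-elim ∘ knight-irrefl {a}) (⊥-elim ∘ n≢1 ∘ wraps)
      where
      n≢1 : 1 ≢ n
      n≢1 = NP.<⇒≢ (NP.≤-trans (s≤s (s≤s z≤n)) (s≤s length≥2))
      wraps : CycNext n Fin.zero Fin.zero ⊎ CycNext n Fin.zero Fin.zero → 1 ≡ n
      wraps (inj₁ (inj₁ ()))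
      wraps (inj₂ (inj₁ ()))
      wraps (inj₁ (inj₂ (e , _))) = e
      wraps (inj₂ (inj₂ (e , _))) = e
    cycle-knight⇔ Fin.zero    (Fin.suc j) = mk⇔ (apex-knight⁺ j) (apex-knight⁻ j)
    cycle-knight⇔ (Fin.suc i) Fin.zero    =
      mk⇔ (Sum.swap ∘ apex-knight⁺ i ∘ knight-sym {lookup l i} {a}) (knight-sym {a} {lookup l i} ∘ apex-knight⁻ i ∘ Sum.swap)
    cycle-knight⇔ (Fin.suc i) (Fin.suc j) = inner-knight⇔ i j

    inducedCycle⇒isCycle : KnightGraphIsCycle (_∈ a ∷ l)
    inducedCycle⇒isCycle =
      n , s≤s length≥2 , lookup (a ∷ l) , cycle-injective ,
      (λ z → mk⇔ (λ z∈ → Any.index z∈ , sym (AnyP.lookup-index z∈)) (λ { (i , refl) → ∈-lookup i })) ,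
      cycle-knight⇔

  isCycle-resp-⇔ : ∀ {S T : CellSet} → (∀ c → S c ⇔ T c) → KnightGraphIsCycle T → KnightGraphIsCycle S
  isCycle-resp-⇔ S⇔T (n , n≥3 , f , f-inj , T⇔im , adj) = n , n≥3 , f , f-inj , (λ c → ⇔-trans (S⇔T c) (T⇔im c)) , adj

  map-cycle : ∀ {g a c b l} → KnightIsometry g → InducedCycle a c b l → InducedCycle (g a) (g c) (g b) (map g l)
  map-cycle {g} {a} {c} {b} {l} iso C = record
    { path       = map-path iso path
    ; apex-first = preserves apex-first
    ; apex-last  = preserves apex-last
    ; apex∉      = ∉-map iso apex∉
    ; apex-only  = only
    ; length≥2   = subst (2 ℕ.≤_) (sym (length-map g l)) length≥2
    }
    where
    open InducedCycle C
    open KnightIsometry iso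
    only : ∀ {z} → z ∈ map g l → Knight (g a) z → z ≡ g c ⊎ z ≡ g b
    only z∈ k with ∈-map⁻ g z∈
    ... | u , u∈ , refl = Sum.map (cong g) (cong g) (apex-only u∈ (reflects k))

  Separated : Cell → Cell → Set
  Separated u v = u ≢ v × ¬ Knight u v

  separated-sym : ∀ {u v} → Separated u v → Separated v u
  separated-sym {u} {v} (u≢v , ¬k) = u≢v ∘ sym , ¬k ∘ knight-sym {v} {u}

  private
    i+3-i≡3 : ∀ i → (i + + 3) - i ≡ + 3
    i+3-i≡3 = solve-∀

    3≤∣i-j∣ : ∀ {i j} → i + + 3 ≤ j → 3 ℕ.≤ ∣ i - j ∣
    3≤∣i-j∣ {i} {j} i+3≤j = subst (3 ℕ.≤_) (ℤP.∣i-j∣≡∣j-i∣ j i) (3≤∣∣ (subst (_≤ j - i) (i+3-i≡3 i) (ℤP.+-monoˡ-≤ (- i) i+3≤j)))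
      where
      3≤∣∣ : ∀ {d} → + 3 ≤ d → 3 ℕ.≤ ∣ d ∣
      3≤∣∣ (+≤+ 3≤n) = 3≤n

    i+3≤j⇒i≢j : ∀ {i j} → i + + 3 ≤ j → i ≢ j
    i+3≤j⇒i≢j {i} i+3≤j refl with subst (3 ℕ.≤_) (cong ∣_∣ (ℤP.+-inverseʳ i)) (3≤∣i-j∣ {i} {i} i+3≤j)
    ... | ()

    3≤⇒≢1 : ∀ {n} → 3 ℕ.≤ n → n ≢ 1
    3≤⇒≢1 (s≤s (s≤s (s≤s _))) ()

    3≤⇒≢2 : ∀ {n} → 3 ℕ.≤ n → n ≢ 2
    3≤⇒≢2 (s≤s (s≤s (s≤s _))) ()

  separated-x : ∀ {u v} → proj₁ u + + 3 ≤ proj₁ v → Separated u v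
  separated-x {u} {v} u₁+3≤v₁ = i+3≤j⇒i≢j {proj₁ u} {proj₁ v} u₁+3≤v₁ ∘ cong proj₁ , ¬knight
    where
    far : 3 ℕ.≤ ∣ proj₁ u - proj₁ v ∣
    far = 3≤∣i-j∣ {proj₁ u} {proj₁ v} u₁+3≤v₁
    ¬knight : ¬ Knight u v
    ¬knight (inj₁ (dx , _)) = 3≤⇒≢1 far dx
    ¬knight (inj₂ (dx , _)) = 3≤⇒≢2 far dx

  separated-y : ∀ {u v} → proj₂ u + + 3 ≤ proj₂ v → Separated u v
  separated-y {u} {v} u₂+3≤v₂ = i+3≤j⇒i≢j {proj₂ u} {proj₂ v} u₂+3≤v₂ ∘ cong proj₂ , ¬knight
    where
    far : 3 ℕ.≤ ∣ proj₂ u - proj₂ v ∣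
    far = 3≤∣i-j∣ {proj₂ u} {proj₂ v} u₂+3≤v₂
    ¬knight : ¬ Knight u v
    ¬knight (inj₁ (_ , dy)) = 3≤⇒≢2 far dy
    ¬knight (inj₂ (_ , dy)) = 3≤⇒≢1 far dy

  -- Zigzag runs

  applyUpTo-path : (f : ℕ → Cell) → (∀ s → Knight (f s) (f (suc s))) →
    (∀ s t → Knight (f s) (f t) → t ≡ suc s ⊎ s ≡ suc t) → (∀ s t → f s ≡ f t → s ≡ t) →
    ∀ n → InducedPath (f 0) (f n) (applyUpTo f (suc n))
  applyUpTo-path f adj only inj zero    = single (f 0)
  applyUpTo-path f adj only inj (suc n) =
    step (adj 0) f0∉ only₀
      (applyUpTo-path (f ∘ suc) (adj ∘ suc)
        (λ s t k → Sum.map NP.suc-injective NP.suc-injective (only (suc s) (suc t) k))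
        (λ s t e → NP.suc-injective (inj (suc s) (suc t) e)) n)
    where
    f0∉ : f 0 ∉ applyUpTo (f ∘ suc) (suc n)
    f0∉ f0∈ with ∈-applyUpTo⁻ (f ∘ suc) f0∈
    ... | j , _ , e with inj 0 (suc j) e
    ... | ()
    only₀ : ∀ {z} → z ∈ applyUpTo (f ∘ suc) (suc n) → Knight (f 0) z → z ≡ f 1
    only₀ z∈ k with ∈-applyUpTo⁻ (f ∘ suc) z∈
    ... | j , _ , refl with only 0 (suc j) k
    ... | inj₁ refl = refl

  odd : ℕ → Bool
  odd zero    = false
  odd (suc n) = not (odd n)

  bit : Bool → ℕ
  bit false = 0
  bit true  = 1

  row : Bool → ℤ
  row false = + 0
  row true  = + 1

  zigzag : Bool → Bool → ℕ → Cell
  zigzag c b t = (+ (bit c ℕ.+ 2 ℕ.* t) , row (b xor odd t))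

  zigzagRun : Bool → Bool → ℕ → List Cell
  zigzagRun c b n = applyUpTo (zigzag c b) n

  private
    ∣+m-+n∣ : ∀ m n → ∣ + m - + n ∣ ≡ ℕ.∣ m - n ∣
    ∣+m-+n∣ zero    zero    = refl
    ∣+m-+n∣ zero    (suc n) = refl
    ∣+m-+n∣ (suc m) zero    = cong (suc ∘ ∣_∣) (ℤP.+-identityʳ (+ m))
    ∣+m-+n∣ (suc m) (suc n) =
      trans (cong ∣_∣ (trans (ℤP.[1+m]⊖[1+n]≡m⊖n m n) (sym (ℤP.m-n≡m⊖n m n)))) (∣+m-+n∣ m n)

    ∣m-n∣≡2⇒ : ∀ m n → ℕ.∣ m - n ∣ ≡ 2 → m ≡ n ℕ.+ 2 ⊎ n ≡ m ℕ.+ 2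
    ∣m-n∣≡2⇒ zero    n       e = inj₂ e
    ∣m-n∣≡2⇒ (suc m) zero    e = inj₁ e
    ∣m-n∣≡2⇒ (suc m) (suc n) e = Sum.map (cong suc) (cong suc) (∣m-n∣≡2⇒ m n e)

    +2-step : ∀ c t → bit c ℕ.+ 2 ℕ.* t ℕ.+ 2 ≡ bit c ℕ.+ 2 ℕ.* suc t
    +2-step c t = x+2t+2≡x+2[1+t] (bit c) t
      where
      x+2t+2≡x+2[1+t] : ∀ x t → x ℕ.+ 2 ℕ.* t ℕ.+ 2 ≡ x ℕ.+ 2 ℕ.* suc t
      x+2t+2≡x+2[1+t] = NS.solve-∀

    odd-2* : ∀ t → odd (2 ℕ.* t) ≡ false
    odd-2* zero    = refl
    odd-2* (suc t) = trans (cong odd (NP.*-suc 2 t)) (trans (BP.not-involutive _) (odd-2* t))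

    odd-bit+2* : ∀ c t → odd (bit c ℕ.+ 2 ℕ.* t) ≡ c
    odd-bit+2* false t = odd-2* t
    odd-bit+2* true  t = cong not (odd-2* t)

    bit+2*-injective : ∀ {c c′ s t} → bit c ℕ.+ 2 ℕ.* s ≡ bit c′ ℕ.+ 2 ℕ.* t → c ≡ c′ × s ≡ t
    bit+2*-injective {c} {c′} {s} {t} e with trans (sym (odd-bit+2* c s)) (trans (cong odd e) (odd-bit+2* c′ t))
    ... | refl = refl , NP.*-cancelˡ-≡ s t 2 (NP.+-cancelˡ-≡ (bit c) _ _ e)

    ∣row-row-not∣ : ∀ x → ∣ row x - row (not x) ∣ ≡ 1
    ∣row-row-not∣ false = refl
    ∣row-row-not∣ true  = refl

    ∣row-row∣≢2 : ∀ x y → ∣ row x - row y ∣ ≢ 2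
    ∣row-row∣≢2 false false ()
    ∣row-row∣≢2 false true  ()
    ∣row-row∣≢2 true  false ()
    ∣row-row∣≢2 true  true  ()

    row-xor-injective : ∀ {b b′ o} → row (b xor o) ≡ row (b′ xor o) → b ≡ b′
    row-xor-injective {false} {false}         _  = refl
    row-xor-injective {true}  {true}          _  = refl
    row-xor-injective {false} {true}  {false} ()
    row-xor-injective {false} {true}  {true}  ()
    row-xor-injective {true}  {false} {false} ()
    row-xor-injective {true}  {false} {true}  ()

    rows-adjacent : ∀ b b′ o → ∣ row (b xor not o) - row (b′ xor o) ∣ ≡ 1 → b ≡ b′
    rows-adjacent false false _     _  = refl
    rows-adjacent true  true  _     _  = refl
    rows-adjacent false true  false ()
    rows-adjacent false true  true  ()
    rows-adjacent true  false false ()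
    rows-adjacent true  false true  ()

  zigzag-knight : ∀ c b s → Knight (zigzag c b s) (zigzag c b (suc s))
  zigzag-knight c b s = inj₂ (dx , dy)
    where
    dx : ∣ + (bit c ℕ.+ 2 ℕ.* s) - + (bit c ℕ.+ 2 ℕ.* suc s) ∣ ≡ 2
    dx = trans (∣+m-+n∣ x (bit c ℕ.+ 2 ℕ.* suc s)) (trans (cong (λ z → ℕ.∣ x - z ∣) (sym (+2-step c s))) (NP.∣m-m+n∣≡n x 2))
      where x = bit c ℕ.+ 2 ℕ.* s
    dy : ∣ row (b xor odd s) - row (b xor not (odd s)) ∣ ≡ 1
    dy = subst (λ z → ∣ row (b xor odd s) - row z ∣ ≡ 1) (BP.not-distribʳ-xor b (odd s)) (∣row-row-not∣ (b xor odd s))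

  zigzag-knight⇒ : ∀ {c b s c′ b′ t} → Knight (zigzag c b s) (zigzag c′ b′ t) →
                   c ≡ c′ × b ≡ b′ × (t ≡ suc s ⊎ s ≡ suc t)
  zigzag-knight⇒ {c} {b} {s} {c′} {b′} {t} (inj₁ (_ , dy)) = ⊥-elim (∣row-row∣≢2 (b xor odd s) (b′ xor odd t) dy)
  zigzag-knight⇒ {c} {b} {s} {c′} {b′} {t} (inj₂ (dx , dy))
    with ∣m-n∣≡2⇒ (bit c ℕ.+ 2 ℕ.* s) (bit c′ ℕ.+ 2 ℕ.* t) (trans (sym (∣+m-+n∣ (bit c ℕ.+ 2 ℕ.* s) (bit c′ ℕ.+ 2 ℕ.* t))) dx)
  ... | inj₁ e with bit+2*-injective {c} {c′} {s} {suc t} (trans e (+2-step c′ t))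
  ...   | refl , refl = refl , rows-adjacent b b′ (odd t) dy , inj₂ refl
  zigzag-knight⇒ {c} {b} {s} {c′} {b′} {t} (inj₂ (dx , dy))
      | inj₂ e with bit+2*-injective {c′} {c} {t} {suc s} (trans e (+2-step c s))
  ...   | refl , refl =
    refl , sym (rows-adjacent b′ b (odd s) (trans (ℤP.∣i-j∣≡∣j-i∣ (row (b′ xor not (odd s))) (row (b xor odd s))) dy)) , inj₁ refl

  zigzag-≡⇒ : ∀ {c b s c′ b′ t} → zigzag c b s ≡ zigzag c′ b′ t → c ≡ c′ × b ≡ b′ × s ≡ t
  zigzag-≡⇒ {c} {b} {s} {c′} {b′} {t} e with bit+2*-injective {c} {c′} {s} {t} (ℤP.+-injective (cong proj₁ e))
  ... | refl , refl = refl , row-xor-injective {b} {b′} {odd s} (cong proj₂ e) , refl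

  zigzagRun-path : ∀ c b n → InducedPath (zigzag c b 0) (zigzag c b n) (zigzagRun c b (suc n))
  zigzagRun-path c b = applyUpTo-path (zigzag c b) (zigzag-knight c b)
    (λ s t → proj₂ ∘ proj₂ ∘ zigzag-knight⇒ {c} {b} {s} {c} {b} {t}) (λ s t → proj₂ ∘ proj₂ ∘ zigzag-≡⇒ {c} {b} {s} {c} {b} {t})

  ∈-zigzagRun⁻ : ∀ {c b n u} → u ∈ zigzagRun c b n → ∃ λ t → t < n × u ≡ zigzag c b t
  ∈-zigzagRun⁻ {c} {b} = ∈-applyUpTo⁻ (zigzag c b)

  zigzag-separated : ∀ {c b c′ b′} → (c , b) ≢ (c′ , b′) → ∀ s t → Separated (zigzag c b s) (zigzag c′ b′ t)
  zigzag-separated {c} {b} {c′} {b′} cb≢ s t =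
    (λ e → let c≡ , b≡ , _ = zigzag-≡⇒ {c} {b} {s} {c′} {b′} {t} e in cb≢ (cong₂ _,_ c≡ b≡)) ,
    (λ k → let c≡ , b≡ , _ = zigzag-knight⇒ {c} {b} {s} {c′} {b′} {t} k in cb≢ (cong₂ _,_ c≡ b≡))

  bit+2*-surjective : ∀ n → ∃₂ λ c t → n ≡ bit c ℕ.+ 2 ℕ.* t
  bit+2*-surjective zero = false , 0 , refl
  bit+2*-surjective (suc n) with bit+2*-surjective n
  ... | false , t , refl = true , t , refl
  ... | true  , t , refl = false , suc t , sym (NP.*-suc 2 t)

  -- Certified separation of symbolic zones

  T-∧⁻ : ∀ {x y} → T (x ∧ y) → T x × T y
  T-∧⁻ = Equivalence.to BP.T-∧

  T-∨⁻ : ∀ {x y} → T (x ∨ y) → T x ⊎ T y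
  T-∨⁻ = Equivalence.to BP.T-∨

  all-∈ : ∀ {A : Set} (p : A → Bool) {xs x} → T (all p xs) → x ∈ xs → T (p x)
  all-∈ p {xs} t = All.lookup (AllP.all⁺ p xs t)

  knight? : ∀ a b → Dec (Knight a b)
  knight? (x₁ , y₁) (x₂ , y₂) =
    ((∣ x₁ - x₂ ∣ ℕ.≟ 1) ×-dec (∣ y₁ - y₂ ∣ ℕ.≟ 2)) ⊎-dec ((∣ x₁ - x₂ ∣ ℕ.≟ 2) ×-dec (∣ y₁ - y₂ ∣ ℕ.≟ 1))

  _≟ᶜ_ : DecidableEquality Cell
  _≟ᶜ_ = ≡-dec ℤ._≟_ ℤ._≟_

  -- Cells of a twine of unknown width R are named relative to either end, so that one check covers all widths.
  data Abscissa : Set where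
    left right : ℤ → Abscissa

  abscissa : ℤ → Abscissa → ℤ
  abscissa R (left a)  = a
  abscissa R (right a) = R + a

  _≟ₐ_ : DecidableEquality Abscissa
  left a  ≟ₐ left b  = Dec.map′ (cong left)  (λ { refl → refl }) (a ℤ.≟ b)
  right a ≟ₐ right b = Dec.map′ (cong right) (λ { refl → refl }) (a ℤ.≟ b)
  left _  ≟ₐ right _ = no λ ()
  right _ ≟ₐ left _  = no λ ()

  SymCell : Set
  SymCell = Abscissa × ℤ

  _≟ₛ_ : DecidableEquality SymCell
  _≟ₛ_ = ≡-dec _≟ₐ_ ℤ._≟_

  cellAt : ℤ → SymCell → Cell
  cellAt R (x , y) = (abscissa R x , y)

  data Zone : Set where
    point  : Abscissa → ℤ → Zone
    box    : Abscissa → Abscissa → ℤ → ℤ → Zone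
    column : Abscissa → Abscissa → ℤ → Zone

  InZone : ℤ → Zone → Cell → Set
  InZone R (point x y)       c       = c ≡ cellAt R (x , y)
  InZone R (box xl xh yl yh) (x , y) = (abscissa R xl ≤ x × x ≤ abscissa R xh) × (yl ≤ y × y ≤ yh)
  InZone R (column xl xh yl) (x , y) = (abscissa R xl ≤ x × x ≤ abscissa R xh) × yl ≤ y

  Covers : ℤ → List Zone → List Cell → Set
  Covers R zs l = ∀ {u} → u ∈ l → Any (λ z → InZone R z u) zs

  loX hiX : Zone → Abscissa
  loX (point x _)     = x
  loX (box xl _ _ _)  = xl
  loX (column xl _ _) = xl
  hiX (point x _)     = x
  hiX (box _ xh _ _)  = xh
  hiX (column _ xh _) = xh

  loY : Zone → ℤ
  loY (point _ y)     = y
  loY (box _ _ yl _)  = yl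
  loY (column _ _ yl) = yl

  hiY : Zone → Maybe ℤ
  hiY (point _ y)    = just y
  hiY (box _ _ _ yh) = just yh
  hiY (column _ _ _) = nothing

  module _ {R : ℤ} where
    loX≤ : ∀ z {c} → InZone R z c → abscissa R (loX z) ≤ proj₁ c
    loX≤ (point _ _)    refl        = ℤP.≤-refl
    loX≤ (box _ _ _ _)  ((p , _) , _) = p
    loX≤ (column _ _ _) ((p , _) , _) = p

    ≤hiX : ∀ z {c} → InZone R z c → proj₁ c ≤ abscissa R (hiX z)
    ≤hiX (point _ _)    refl        = ℤP.≤-refl
    ≤hiX (box _ _ _ _)  ((_ , p) , _) = p
    ≤hiX (column _ _ _) ((_ , p) , _) = p

    loY≤ : ∀ z {c} → InZone R z c → loY z ≤ proj₂ c
    loY≤ (point _ _)    refl        = ℤP.≤-refl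
    loY≤ (box _ _ _ _)  (_ , (p , _)) = p
    loY≤ (column _ _ _) (_ , p)       = p

    ≤hiY : ∀ z {c m} → InZone R z c → hiY z ≡ just m → proj₂ c ≤ m
    ≤hiY (point _ _)   refl          refl = ℤP.≤-refl
    ≤hiY (box _ _ _ _) (_ , (_ , p)) refl = p

  -- Decides a + g ≤ b uniformly in the widths R ≥ R₀; answers false when that depends on R.
  offset≤ᵇ : ℤ → ℤ → Abscissa → Abscissa → Bool
  offset≤ᵇ R₀ g (left a)  (left b)  = a + g ≤ᵇ b
  offset≤ᵇ R₀ g (right a) (right b) = a + g ≤ᵇ b
  offset≤ᵇ R₀ g (left a)  (right b) = a + g ≤ᵇ R₀ + b
  offset≤ᵇ R₀ g (right _) (left _)  = false

  offset≤ᵇ-sound : ∀ {R₀ R} g → R₀ ≤ R → ∀ a b → T (offset≤ᵇ R₀ g a b) → abscissa R a + g ≤ abscissa R b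
  offset≤ᵇ-sound g R₀≤R (left a)  (left b)  t = ℤP.≤ᵇ⇒≤ t
  offset≤ᵇ-sound {R = R} g R₀≤R (right a) (right b) t =
    subst (_≤ R + b) (sym (ℤP.+-assoc R a g)) (ℤP.+-monoʳ-≤ R (ℤP.≤ᵇ⇒≤ t))
  offset≤ᵇ-sound g R₀≤R (left a)  (right b) t = ℤP.≤-trans (ℤP.≤ᵇ⇒≤ t) (ℤP.+-monoˡ-≤ b R₀≤R)

  private
    below3ᵇ : Maybe ℤ → ℤ → Bool
    below3ᵇ nothing  _ = false
    below3ᵇ (just m) l = m + + 3 ≤ᵇ l

    below3ᵇ-sound : ∀ {R} z z′ {u v} → InZone R z u → InZone R z′ v → T (below3ᵇ (hiY z) (loY z′)) →
                    proj₂ u + + 3 ≤ proj₂ v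
    below3ᵇ-sound z z′ u∈ v∈ t with hiY z in eq
    ... | just m = ℤP.≤-trans (ℤP.+-monoˡ-≤ (+ 3) (≤hiY z u∈ eq)) (ℤP.≤-trans (ℤP.≤ᵇ⇒≤ t) (loY≤ z′ v∈))

  farᵇ : ℤ → Zone → Zone → Bool
  farᵇ R₀ z z′ = offset≤ᵇ R₀ (+ 3) (hiX z) (loX z′) ∨ offset≤ᵇ R₀ (+ 3) (hiX z′) (loX z)
               ∨ below3ᵇ (hiY z) (loY z′) ∨ below3ᵇ (hiY z′) (loY z)

  farᵇ-sound : ∀ {R₀ R} → R₀ ≤ R → ∀ z z′ {u v} → InZone R z u → InZone R z′ v → T (farᵇ R₀ z z′) → Separated u v
  farᵇ-sound {R₀} {R} R₀≤R z z′ u∈ v∈ t with T-∨⁻ t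
  ... | inj₁ t₁ = separated-x (x-gap z z′ u∈ v∈ t₁)
    where
    x-gap : ∀ z z′ {u v} → InZone R z u → InZone R z′ v → T (offset≤ᵇ R₀ (+ 3) (hiX z) (loX z′)) →
            proj₁ u + + 3 ≤ proj₁ v
    x-gap z z′ u∈ v∈ t = ℤP.≤-trans (ℤP.+-monoˡ-≤ (+ 3) (≤hiX z u∈))
                           (ℤP.≤-trans (offset≤ᵇ-sound (+ 3) R₀≤R (hiX z) (loX z′) t) (loX≤ z′ v∈))
  ... | inj₂ t₂ with T-∨⁻ t₂
  ... | inj₁ t₃ = separated-sym (separated-x (ℤP.≤-trans (ℤP.+-monoˡ-≤ (+ 3) (≤hiX z′ v∈))
                    (ℤP.≤-trans (offset≤ᵇ-sound (+ 3) R₀≤R (hiX z′) (loX z) t₃) (loX≤ z u∈))))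
  ... | inj₂ t₄ with T-∨⁻ t₄
  ... | inj₁ t₅ = separated-y (below3ᵇ-sound z z′ u∈ v∈ t₅)
  ... | inj₂ t₆ = separated-sym (separated-y (below3ᵇ-sound z′ z v∈ u∈ t₆))

  emptyᵇ : ℤ → Zone → Bool
  emptyᵇ R₀ z = offset≤ᵇ R₀ (+ 1) (hiX z) (loX z)

  emptyᵇ-sound : ∀ {R₀ R} → R₀ ≤ R → ∀ z {u} → InZone R z u → ¬ T (emptyᵇ R₀ z)
  emptyᵇ-sound {R = R} R₀≤R z u∈ t =
    i+1≰i (ℤP.≤-trans (offset≤ᵇ-sound (+ 1) R₀≤R (hiX z) (loX z) t) (ℤP.≤-trans (loX≤ z u∈) (≤hiX z u∈)))
    where
    i+1-i≡1 : ∀ i → (i + + 1) - i ≡ + 1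
    i+1-i≡1 = solve-∀
    i+1≰i : ∀ {i} → ¬ i + + 1 ≤ i
    i+1≰i {i} i+1≤i with subst₂ _≤_ (i+1-i≡1 i) (ℤP.+-inverseʳ i) (ℤP.+-monoˡ-≤ (- i) i+1≤i)
    ... | +≤+ ()

  Link : Set
  Link = SymCell × SymCell

  Linked : ℤ → List Link → Cell → Cell → Set
  Linked R links u v = Any (λ (p , q) → u ≡ cellAt R p × v ≡ cellAt R q) links

  linkedᵇ : List Link → SymCell → SymCell → Bool
  linkedᵇ links p q = any (λ (p′ , q′) → ⌊ p ≟ₛ p′ ⌋ ∧ ⌊ q ≟ₛ q′ ⌋) links

  linkedᵇ-sound : ∀ {R} links p q → T (linkedᵇ links p q) → Linked R links (cellAt R p) (cellAt R q)
  linkedᵇ-sound {R} links p q t = Any.map both (AnyP.any⁻ _ links t)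
    where
    both : ∀ {pq} → T (⌊ p ≟ₛ proj₁ pq ⌋ ∧ ⌊ q ≟ₛ proj₂ pq ⌋) → cellAt R p ≡ cellAt R (proj₁ pq) × cellAt R q ≡ cellAt R (proj₂ pq)
    both {pq} t′ = let tp , tq = T-∧⁻ {⌊ p ≟ₛ proj₁ pq ⌋} t′ in cong (cellAt R) (toWitness tp) , cong (cellAt R) (toWitness tq)

  Compatible : ℤ → List Link → Cell → Cell → Set
  Compatible R links u v = u ≢ v × (Knight u v → Linked R links u v)

  separated⇒compatible : ∀ {R links u v} → Separated u v → Compatible R links u v
  separated⇒compatible (u≢v , ¬k) = u≢v , ⊥-elim ∘ ¬k

  private
    offsetsᵇ : List Link → SymCell → SymCell → Cell → Cell → Bool
    offsetsᵇ links p q o o′ = not ⌊ o ≟ᶜ o′ ⌋ ∧ (not ⌊ knight? o o′ ⌋ ∨ linkedᵇ links p q)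

    offsetsᵇ-sound : ∀ {R} links p q {o o′} → (cellAt R p ≡ cellAt R q → o ≡ o′) →
      (Knight (cellAt R p) (cellAt R q) → Knight o o′) → T (offsetsᵇ links p q o o′) →
      Compatible R links (cellAt R p) (cellAt R q)
    offsetsᵇ-sound {R} links p q {o} {o′} ≡⇒ k⇒ t with T-∧⁻ {not ⌊ o ≟ᶜ o′ ⌋} t
    ... | t≢ , t-link = toWitnessFalse t≢ ∘ ≡⇒ , λ k → Sum.[ (λ t¬k → ⊥-elim (toWitnessFalse t¬k (k⇒ k))) ,
                                                             linkedᵇ-sound links p q ]′ (T-∨⁻ t-link)

  pointsᵇ : ℤ → List Link → SymCell → SymCell → Bool
  pointsᵇ R₀ links p@(left a , y)  q@(left a′ , y′)  = offsetsᵇ links p q (a , y) (a′ , y′)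
  pointsᵇ R₀ links p@(right a , y) q@(right a′ , y′) = offsetsᵇ links p q (a , y) (a′ , y′)
  pointsᵇ R₀ links (x , y)         (x′ , y′)         = farᵇ R₀ (point x y) (point x′ y′)

  zonesᵇ : ℤ → List Link → Zone → Zone → Bool
  zonesᵇ R₀ links (point x y) (point x′ y′) = pointsᵇ R₀ links (x , y) (x′ , y′)
  zonesᵇ R₀ links z z′ = emptyᵇ R₀ z ∨ emptyᵇ R₀ z′ ∨ farᵇ R₀ z z′

  private
    nonPoint-sound : ∀ {R₀ R} → R₀ ≤ R → ∀ links z z′ {u v} → InZone R z u → InZone R z′ v →
                     T (emptyᵇ R₀ z ∨ emptyᵇ R₀ z′ ∨ farᵇ R₀ z z′) → Compatible R links u v
    nonPoint-sound {R₀} R₀≤R links z z′ u∈ v∈ t with T-∨⁻ {emptyᵇ R₀ z} t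
    ... | inj₁ t₁ = ⊥-elim (emptyᵇ-sound R₀≤R z u∈ t₁)
    ... | inj₂ t₂ with T-∨⁻ {emptyᵇ R₀ z′} t₂
    ... | inj₁ t₃ = ⊥-elim (emptyᵇ-sound R₀≤R z′ v∈ t₃)
    ... | inj₂ t₄ = separated⇒compatible (farᵇ-sound R₀≤R z z′ u∈ v∈ t₄)

  zonesᵇ-sound : ∀ {R₀ R} → R₀ ≤ R → ∀ links z z′ {u v} → InZone R z u → InZone R z′ v →
                 T (zonesᵇ R₀ links z z′) → Compatible R links u v
  zonesᵇ-sound {R = R} _ links (point (left a) y) (point (left a′) y′) refl refl t =
    offsetsᵇ-sound links (left a , y) (left a′ , y′) id id t
  zonesᵇ-sound {R = R} _ links (point (right a) y) (point (right a′) y′) refl refl t =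
    offsetsᵇ-sound links (right a , y) (right a′ , y′) (injective {a , y} {a′ , y′}) (reflects {a , y} {a′ , y′}) t
    where open KnightIsometry (shift-isometry R)
  zonesᵇ-sound R₀≤R links z@(point (left _) _)  z′@(point (right _) _) u∈ v∈ t =
    separated⇒compatible (farᵇ-sound R₀≤R z z′ u∈ v∈ t)
  zonesᵇ-sound R₀≤R links z@(point (right _) _) z′@(point (left _) _)  u∈ v∈ t =
    separated⇒compatible (farᵇ-sound R₀≤R z z′ u∈ v∈ t)
  zonesᵇ-sound R₀≤R links z@(point _ _)    z′@(box _ _ _ _)  u∈ v∈ t = nonPoint-sound R₀≤R links z z′ u∈ v∈ t
  zonesᵇ-sound R₀≤R links z@(point _ _)    z′@(column _ _ _) u∈ v∈ t = nonPoint-sound R₀≤R links z z′ u∈ v∈ t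
  zonesᵇ-sound R₀≤R links z@(box _ _ _ _)  z′                u∈ v∈ t = nonPoint-sound R₀≤R links z z′ u∈ v∈ t
  zonesᵇ-sound R₀≤R links z@(column _ _ _) z′                u∈ v∈ t = nonPoint-sound R₀≤R links z z′ u∈ v∈ t

  zoneListsᵇ : ℤ → List Link → List Zone → List Zone → Bool
  zoneListsᵇ R₀ links zs zs′ = all (λ z → all (zonesᵇ R₀ links z) zs′) zs

  zoneListsᵇ-sound : ∀ {R₀ R} → R₀ ≤ R → ∀ links zs zs′ {l m} → T (zoneListsᵇ R₀ links zs zs′) →
    Covers R zs l → Covers R zs′ m → ∀ {u v} → u ∈ l → v ∈ m → Compatible R links u v
  zoneListsᵇ-sound {R₀} R₀≤R links zs zs′ t cov cov′ u∈ v∈ =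
    let z  , z∈  , u∈z  = find (cov u∈)
        z′ , z′∈ , v∈z′ = find (cov′ v∈)
    in zonesᵇ-sound R₀≤R links z z′ u∈z v∈z′ (all-∈ (zonesᵇ R₀ links z) (all-∈ _ t z∈) z′∈)

  private
    _≤ᵐᵇ_ : Maybe ℤ → Maybe ℤ → Bool
    just m  ≤ᵐᵇ just m′ = m ≤ᵇ m′
    _       ≤ᵐᵇ nothing = true
    nothing ≤ᵐᵇ just _  = false

    isPointᵇ : Zone → SymCell → Bool
    isPointᵇ (point x y) p = ⌊ (x , y) ≟ₛ p ⌋
    isPointᵇ _           _ = false

    boundsᵇ : ℤ → Zone → Zone → Bool
    boundsᵇ R₀ z z′ = offset≤ᵇ R₀ (+ 0) (loX z′) (loX z) ∧ offset≤ᵇ R₀ (+ 0) (hiX z) (hiX z′)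
                      ∧ (loY z′ ≤ᵇ loY z) ∧ (hiY z ≤ᵐᵇ hiY z′)

  ⊆ᵇ : ℤ → Zone → Zone → Bool
  ⊆ᵇ R₀ z (point x′ y′)        = isPointᵇ z (x′ , y′)
  ⊆ᵇ R₀ z z′@(box _ _ _ _)     = boundsᵇ R₀ z z′
  ⊆ᵇ R₀ z z′@(column _ _ _)    = boundsᵇ R₀ z z′

  module _ {R₀ R} (R₀≤R : R₀ ≤ R) where
    private
      left-bound : ∀ z {u} x → T (offset≤ᵇ R₀ (+ 0) x (loX z)) → InZone R z u → abscissa R x ≤ proj₁ u
      left-bound z x t u∈ =
        ℤP.≤-trans (subst (_≤ _) (ℤP.+-identityʳ _) (offset≤ᵇ-sound (+ 0) R₀≤R x (loX z) t)) (loX≤ z u∈)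

      right-bound : ∀ z {u} x → T (offset≤ᵇ R₀ (+ 0) (hiX z) x) → InZone R z u → proj₁ u ≤ abscissa R x
      right-bound z x t u∈ =
        ℤP.≤-trans (≤hiX z u∈) (subst (_≤ _) (ℤP.+-identityʳ _) (offset≤ᵇ-sound (+ 0) R₀≤R (hiX z) x t))

      top-bound : ∀ z {u m} → T (hiY z ≤ᵐᵇ just m) → InZone R z u → proj₂ u ≤ m
      top-bound z t u∈ with hiY z in eq
      ... | just m = ℤP.≤-trans (≤hiY z u∈ eq) (ℤP.≤ᵇ⇒≤ t)

    ⊆ᵇ-sound : ∀ z z′ {u} → T (⊆ᵇ R₀ z z′) → InZone R z u → InZone R z′ u
    ⊆ᵇ-sound (point x y)    (point x′ y′)     t refl = cong (cellAt R) (toWitness t)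
    ⊆ᵇ-sound (box _ _ _ _)  (point _ _)       ()
    ⊆ᵇ-sound (column _ _ _) (point _ _)       ()
    ⊆ᵇ-sound z              (box xl xh yl yh) t u∈ with T-∧⁻ {offset≤ᵇ R₀ (+ 0) xl (loX z)} t
    ... | tl , t′ with T-∧⁻ {offset≤ᵇ R₀ (+ 0) (hiX z) xh} t′
    ... | tr , t″ with T-∧⁻ {yl ≤ᵇ loY z} t″
    ... | tb , t-top = (left-bound z xl tl u∈ , right-bound z xh tr u∈) , (ℤP.≤-trans (ℤP.≤ᵇ⇒≤ tb) (loY≤ z u∈) , top-bound z t-top u∈)
    ⊆ᵇ-sound z              (column xl xh yl) t u∈ with T-∧⁻ {offset≤ᵇ R₀ (+ 0) xl (loX z)} t
    ... | tl , t′ with T-∧⁻ {offset≤ᵇ R₀ (+ 0) (hiX z) xh} t′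
    ... | tr , t″ with T-∧⁻ {yl ≤ᵇ loY z} t″
    ... | tb , _ = (left-bound z xl tl u∈ , right-bound z xh tr u∈) , ℤP.≤-trans (ℤP.≤ᵇ⇒≤ tb) (loY≤ z u∈)

  zones⊆ᵇ : ℤ → List Zone → List Zone → Bool
  zones⊆ᵇ R₀ zs zs′ = all (λ z → any (⊆ᵇ R₀ z) zs′) zs

  zones⊆ᵇ-sound : ∀ {R₀ R} → R₀ ≤ R → ∀ zs zs′ {l} → T (zones⊆ᵇ R₀ zs zs′) → Covers R zs l → Covers R zs′ l
  zones⊆ᵇ-sound {R₀} R₀≤R zs zs′ t cov u∈ =
    let z  , z∈  , u∈z = find (cov u∈)
        z′ , z′∈ , t′  = find (AnyP.any⁻ (⊆ᵇ R₀ z) zs′ (all-∈ (λ z → any (⊆ᵇ R₀ z) zs′) t z∈))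
    in lose z′∈ (⊆ᵇ-sound R₀≤R z z′ t′ u∈z)

  -- Blocks and chains of blocks

  ZigzagClass : Maybe (Bool × Bool) → List Cell → Set
  ZigzagClass nothing        l = ⊤
  ZigzagClass (just (c , b)) l = ∀ {u} → u ∈ l → ∃ λ t → u ≡ zigzag c b t

  -- A zigzag run records its class: runs of different classes are never adjacent, even where their zones overlap.
  record Block (R : ℤ) : Set where
    field
      start end : SymCell
      cells     : List Cell
      path      : InducedPath (cellAt R start) (cellAt R end) cells
      zones     : List Zone
      covers    : Covers R zones cells
      class     : Maybe (Bool × Bool)
      in-class  : ZigzagClass class cells
  open Block public

  private
    distinctClassᵇ : Maybe (Bool × Bool) → Maybe (Bool × Bool) → Bool
    distinctClassᵇ (just cb) (just cb′) = not ⌊ ≡-dec BP._≟_ BP._≟_ cb cb′ ⌋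
    distinctClassᵇ _         _          = false

    distinctClassᵇ-sound : ∀ {R links} m m′ {l l′} → T (distinctClassᵇ m m′) → ZigzagClass m l → ZigzagClass m′ l′ →
                           ∀ {u v} → u ∈ l → v ∈ l′ → Compatible R links u v
    distinctClassᵇ-sound (just cb) (just cb′) t in-cb in-cb′ u∈ v∈ with in-cb u∈ | in-cb′ v∈
    ... | s , refl | s′ , refl = separated⇒compatible (zigzag-separated (toWitnessFalse t) s s′)

  blocksᵇ : ∀ {R} → ℤ → List Link → Block R → Block R → Bool
  blocksᵇ R₀ links B B′ = distinctClassᵇ (class B) (class B′) ∨ zoneListsᵇ R₀ links (zones B) (zones B′)

  blocksᵇ-sound : ∀ {R₀ R} → R₀ ≤ R → ∀ links (B B′ : Block R) → T (blocksᵇ R₀ links B B′) →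
                  ∀ {u v} → u ∈ cells B → v ∈ cells B′ → Compatible R links u v
  blocksᵇ-sound {R₀} R₀≤R links B B′ t u∈ v∈ with T-∨⁻ {distinctClassᵇ (class B) (class B′)} t
  ... | inj₁ t₁ = distinctClassᵇ-sound (class B) (class B′) t₁ (in-class B) (in-class B′) u∈ v∈
  ... | inj₂ t₂ = zoneListsᵇ-sound R₀≤R links (zones B) (zones B′) t₂ (covers B) (covers B′) u∈ v∈

  knightᵇ : SymCell → SymCell → Bool
  knightᵇ (left a , y)  (left a′ , y′)  = ⌊ knight? (a , y) (a′ , y′) ⌋
  knightᵇ (right a , y) (right a′ , y′) = ⌊ knight? (a , y) (a′ , y′) ⌋
  knightᵇ _             _               = false

  knightᵇ-sound : ∀ {R} p q → T (knightᵇ p q) → Knight (cellAt R p) (cellAt R q)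
  knightᵇ-sound         (left a , y)  (left a′ , y′)  t = toWitness t
  knightᵇ-sound {R = R} (right a , y) (right a′ , y′) t =
    KnightIsometry.preserves (shift-isometry R) {a , y} {a′ , y′} (toWitness t)

  chainCells : ∀ {R} → Block R → List (Block R) → List Cell
  chainCells B []        = cells B
  chainCells B (B′ ∷ Bs) = cells B ++ chainCells B′ Bs

  chainEnd : ∀ {R} → Block R → List (Block R) → SymCell
  chainEnd B []        = end B
  chainEnd B (B′ ∷ Bs) = chainEnd B′ Bs

  chainᵇ : ∀ {R} → ℤ → Block R → List (Block R) → Bool
  chainᵇ R₀ B []        = true
  chainᵇ R₀ B (B′ ∷ Bs) = knightᵇ (end B) (start B′) ∧ blocksᵇ R₀ ((end B , start B′) ∷ []) B B′
                          ∧ all (blocksᵇ R₀ [] B) Bs ∧ chainᵇ R₀ B′ Bs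

  ∈-chainCells⁻ : ∀ {R} (B : Block R) Bs {v} → v ∈ chainCells B Bs → ∃ λ B′ → B′ ∈ B ∷ Bs × v ∈ cells B′
  ∈-chainCells⁻ B []        v∈ = B , here refl , v∈
  ∈-chainCells⁻ B (B′ ∷ Bs) v∈ with ∈-++⁻ (cells B) v∈
  ... | inj₁ v∈B = B , here refl , v∈B
  ... | inj₂ v∈Bs with ∈-chainCells⁻ B′ Bs v∈Bs
  ... | B″ , B″∈ , v∈B″ = B″ , there B″∈ , v∈B″

  chain-path : ∀ {R₀ R} → R₀ ≤ R → (B : Block R) (Bs : List (Block R)) → T (chainᵇ R₀ B Bs) →
               InducedPath (cellAt R (start B)) (cellAt R (chainEnd B Bs)) (chainCells B Bs)
  chain-path R₀≤R B []        t = path B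
  chain-path {R₀} {R} R₀≤R B (B′ ∷ Bs) t
    with T-∧⁻ {knightᵇ (end B) (start B′)} t
  ... | t-knight , t′ with T-∧⁻ {blocksᵇ R₀ _ B B′} t′
  ... | t-next , t″ with T-∧⁻ {all (blocksᵇ R₀ [] B) Bs} t″
  ... | t-later , t-rest =
    join (path B) (chain-path R₀≤R B′ Bs t-rest) link (knightᵇ-sound (end B) (start B′) t-knight)
    where
    link : LinkedOnlyAt (cellAt R (end B)) (cellAt R (start B′)) (cells B) (chainCells B′ Bs)
    link u∈ v∈ with ∈-chainCells⁻ B′ Bs v∈
    ... | _ , here refl , v∈B′ =
      let u≢v , k⇒ = blocksᵇ-sound R₀≤R _ B B′ t-next u∈ v∈B′
      in u≢v , λ k → case k⇒ k of λ { (here e) → e }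
    ... | B″ , there B″∈ , v∈B″ =
      let u≢v , k⇒ = blocksᵇ-sound R₀≤R [] B B″ (all-∈ (blocksᵇ R₀ [] B) t-later B″∈) u∈ v∈B″
      in u≢v , λ k → case k⇒ k of λ ()

  chain-covers : ∀ {R₀ R} → R₀ ≤ R → (zs : List Zone) (B : Block R) (Bs : List (Block R)) →
                 T (all (λ B′ → zones⊆ᵇ R₀ (zones B′) zs) (B ∷ Bs)) → Covers R zs (chainCells B Bs)
  chain-covers {R₀} R₀≤R zs B Bs t v∈ with ∈-chainCells⁻ B Bs v∈
  ... | B′ , B′∈ , v∈B′ =
    zones⊆ᵇ-sound R₀≤R (zones B′) zs (all-∈ (λ B′ → zones⊆ᵇ R₀ (zones B′) zs) t B′∈) (covers B′) v∈B′

  chain-cycle : ∀ {R₀ R} → R₀ ≤ R → (a : SymCell) (B : Block R) (Bs : List (Block R)) → T (chainᵇ R₀ B Bs) →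
    T (knightᵇ a (start B)) → T (knightᵇ a (chainEnd B Bs)) →
    T (all (λ B′ → zoneListsᵇ R₀ ((a , start B) ∷ (a , chainEnd B Bs) ∷ []) (point (proj₁ a) (proj₂ a) ∷ []) (zones B′)) (B ∷ Bs)) →
    2 ℕ.≤ length (chainCells B Bs) →
    InducedCycle (cellAt R a) (cellAt R (start B)) (cellAt R (chainEnd B Bs)) (chainCells B Bs)
  chain-cycle {R₀} {R} R₀≤R a B Bs t-chain t-first t-last t-apex length≥2 = record
    { path       = chain-path R₀≤R B Bs t-chain
    ; apex-first = knightᵇ-sound a (start B) t-first
    ; apex-last  = knightᵇ-sound a (chainEnd B Bs) t-last
    ; apex∉      = λ v∈ → proj₁ (apex-compatible v∈) refl
    ; apex-only  = λ v∈ k → linked⇒ (proj₂ (apex-compatible v∈) k)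
    ; length≥2   = length≥2
    }
    where
    links : List Link
    links = (a , start B) ∷ (a , chainEnd B Bs) ∷ []
    apex-covers : Covers R (point (proj₁ a) (proj₂ a) ∷ []) (cellAt R a ∷ [])
    apex-covers (here refl) = here refl
    apex-covers (there ())
    apex-compatible : ∀ {v} → v ∈ chainCells B Bs → Compatible R links (cellAt R a) v
    apex-compatible v∈ with ∈-chainCells⁻ B Bs v∈
    ... | B′ , B′∈ , v∈B′ =
      zoneListsᵇ-sound R₀≤R links (point (proj₁ a) (proj₂ a) ∷ []) (zones B′)
        (all-∈ (λ B′ → zoneListsᵇ R₀ links (point (proj₁ a) (proj₂ a) ∷ []) (zones B′)) t-apex B′∈)
        apex-covers (covers B′) (here refl) v∈B′
    linked⇒ : ∀ {v} → Linked R links (cellAt R a) v → v ≡ cellAt R (start B) ⊎ v ≡ cellAt R (chainEnd B Bs)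
    linked⇒ (here (_ , e))         = inj₁ e
    linked⇒ (there (here (_ , e))) = inj₂ e

  -- The twine above has width R − 8 and is mirrored and four rows higher; flipUp R moves a cell
  -- from its frame into the frame of width R.
  flipUp : ℤ → Cell → Cell
  flipUp R (x , y) = (R - + 1 - x , y + + 4)

  flipUp-isometry : ∀ R → KnightIsometry (flipUp R)
  flipUp-isometry R = ∣Δ∣-preserving⇒isometry
    (λ {a} {b} e → cong₂ _,_
       (trans (sym (x-involutive R (proj₁ a))) (trans (cong (λ z → R - + 1 - z) (cong proj₁ e)) (x-involutive R (proj₁ b))))
       (+-cancelʳ (cong proj₂ e)))
    (λ (x , _) (x′ , _) → trans (cong ∣_∣ (Δx R x x′)) (ℤP.∣i-j∣≡∣j-i∣ x′ x))
    (λ (_ , y) (_ , y′) → cong ∣_∣ (Δy y y′))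
    where
    x-involutive : ∀ R x → R - + 1 - (R - + 1 - x) ≡ x
    x-involutive = solve-∀
    Δx : ∀ R x x′ → (R - + 1 - x) - (R - + 1 - x′) ≡ x′ - x
    Δx = solve-∀
    Δy : ∀ y y′ → (y + + 4) - (y′ + + 4) ≡ y - y′
    Δy = solve-∀
    +-cancelʳ : ∀ {y y′} → y + + 4 ≡ y′ + + 4 → y ≡ y′
    +-cancelʳ {y} {y′} e = +-cancelˡ (+ 4) (trans (ℤP.+-comm (+ 4) y) (trans e (ℤP.+-comm y′ (+ 4))))

  flipUpAbscissa : Abscissa → Abscissa
  flipUpAbscissa (left a)  = right (- + 1 - a)
  flipUpAbscissa (right a) = left (+ 7 - a)

  flipUpZone : Zone → Zone
  flipUpZone (point x y)       = point (flipUpAbscissa x) (y + + 4)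
  flipUpZone (box xl xh yl yh) = box (flipUpAbscissa xh) (flipUpAbscissa xl) (yl + + 4) (yh + + 4)
  flipUpZone (column xl xh yl) = column (flipUpAbscissa xh) (flipUpAbscissa xl) (yl + + 4)

  private
    R+[-1-a]≡R-1-a : ∀ R a → R + (- + 1 - a) ≡ R - + 1 - a
    R+[-1-a]≡R-1-a = solve-∀

    abscissa-flipUp : ∀ R x → abscissa (R + + 8) (flipUpAbscissa x) ≡ (R + + 8) - + 1 - abscissa R x
    abscissa-flipUp R (left a)  = R+[-1-a]≡R-1-a (R + + 8) a
    abscissa-flipUp R (right a) = 7-a≡[R+8]-1-[R+a] R a
      where
      7-a≡[R+8]-1-[R+a] : ∀ R a → + 7 - a ≡ (R + + 8) - + 1 - (R + a)
      7-a≡[R+8]-1-[R+a] = solve-∀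

    mirror-mono : ∀ R {a b} → a ≤ b → R - + 1 - b ≤ R - + 1 - a
    mirror-mono R a≤b = ℤP.+-monoʳ-≤ (R - + 1) (ℤP.neg-mono-≤ a≤b)

  flipUpZone-sound : ∀ R z {u} → InZone R z u → InZone (R + + 8) (flipUpZone z) (flipUp (R + + 8) u)
  flipUpZone-sound R (point x y) refl = cong₂ _,_ (sym (abscissa-flipUp R x)) refl
  flipUpZone-sound R (box xl xh yl yh) ((xl≤ , ≤xh) , (yl≤ , ≤yh)) =
    (subst (_≤ _) (sym (abscissa-flipUp R xh)) (mirror-mono (R + + 8) ≤xh) ,
     subst (_ ≤_) (sym (abscissa-flipUp R xl)) (mirror-mono (R + + 8) xl≤)) ,
    (ℤP.+-monoˡ-≤ (+ 4) yl≤ , ℤP.+-monoˡ-≤ (+ 4) ≤yh)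
  flipUpZone-sound R (column xl xh yl) ((xl≤ , ≤xh) , yl≤) =
    (subst (_≤ _) (sym (abscissa-flipUp R xh)) (mirror-mono (R + + 8) ≤xh) ,
     subst (_ ≤_) (sym (abscissa-flipUp R xl)) (mirror-mono (R + + 8) xl≤)) ,
    ℤP.+-monoˡ-≤ (+ 4) yl≤

  flippedBlock : ∀ R (Q : List Cell) (zs : List Zone) →
    InducedPath (cellAt R (left (+ 1) , + 0)) (cellAt R (left (+ 0) , + 1)) Q → Covers R zs Q → Block (R + + 8)
  flippedBlock R Q zs Q-path Q-covers = record
    { start    = (right (- + 1) , + 5)
    ; end      = (right (- + 2) , + 4)
    ; cells    = reverse (map (flipUp (R + + 8)) Q)
    ; path     = subst₂ (λ a b → InducedPath a b (reverse (map (flipUp (R + + 8)) Q))) (flipUp-at (+ 0) (+ 1)) (flipUp-at (+ 1) (+ 0))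
                   (reverse-path (map-path (flipUp-isometry (R + + 8)) Q-path))
    ; zones    = map flipUpZone zs
    ; covers   = flipped-covers
    ; class    = nothing
    ; in-class = tt
    }
    where
    flipUp-at : ∀ a y → flipUp (R + + 8) (a , y) ≡ cellAt (R + + 8) (right (- + 1 - a) , y + + 4)
    flipUp-at a y = cong₂ _,_ (sym (R+[-1-a]≡R-1-a (R + + 8) a)) refl
    flipped-covers : Covers (R + + 8) (map flipUpZone zs) (reverse (map (flipUp (R + + 8)) Q))
    flipped-covers u∈ with ∈-map⁻ (flipUp (R + + 8)) (AnyP.reverse⁻ u∈)
    ... | u , u∈Q , refl = AnyP.map⁺ (Any.map (flipUpZone-sound R _) (Q-covers u∈Q))

  pointBlock : ∀ R → SymCell → Block R
  pointBlock R p = record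
    { start = p ; end = p ; cells = cellAt R p ∷ [] ; path = single _
    ; zones = point (proj₁ p) (proj₂ p) ∷ [] ; covers = λ { (here refl) → here refl ; (there ()) }
    ; class = nothing ; in-class = tt
    }

  reverseBlock : ∀ {R} → Block R → Block R
  reverseBlock B = record
    { start = end B ; end = start B ; cells = reverse (cells B) ; path = reverse-path (path B)
    ; zones = zones B ; covers = covers B ∘ AnyP.reverse⁻
    ; class = class B ; in-class = reverse-class (class B) (in-class B)
    }
    where
    reverse-class : ∀ m → ZigzagClass m (cells B) → ZigzagClass m (reverse (cells B))
    reverse-class nothing  _  = tt
    reverse-class (just _) in-m = in-m ∘ AnyP.reverse⁻

  -- The twine [0, zigzagWidth c m] × [0, 1] is where the run zigzagRun c b (suc m) starts and ends.
  zigzagWidth : Bool → ℕ → ℕ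
  zigzagWidth c m = bit c ℕ.+ 2 ℕ.* m ℕ.+ bit c

  row-bounds : ∀ b → + 0 ≤ row b × row b ≤ + 1
  row-bounds false = +≤+ z≤n , +≤+ z≤n
  row-bounds true  = +≤+ z≤n , +≤+ (s≤s z≤n)

  odd-pred : ∀ t q → odd (suc t) ≡ q → odd t ≡ not q
  odd-pred t q e = trans (sym (BP.not-involutive (odd t))) (cong not e)

  private
    +[a+k]-+k≡+a : ∀ a k → + (a ℕ.+ k) - + k ≡ + a
    +[a+k]-+k≡+a a k = trans (cong (_- + k) (ℤP.pos-+ a k)) (x+y-y≡x (+ a) (+ k))
      where
      x+y-y≡x : ∀ x y → x + y - y ≡ x
      x+y-y≡x = solve-∀

    +a≤+n-+k : ∀ {a k n} → a ℕ.+ k ℕ.≤ n → + a ≤ + n - + k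
    +a≤+n-+k {a} {k} a+k≤n = subst (_≤ _) (+[a+k]-+k≡+a a k) (ℤP.+-monoˡ-≤ (- + k) (+≤+ a+k≤n))

  zigzagZones : Bool → Bool → Bool → List Zone
  zigzagZones c b q =
    point (left (+ bit c)) (row (b xor false)) ∷ point (left (+ (bit c ℕ.+ 2))) (row (b xor true)) ∷
    box (left (+ 4)) (right (- + 4)) (+ 0) (+ 1) ∷
    point (right (- + (2 ℕ.+ bit c))) (row (b xor not q)) ∷ point (right (- + bit c)) (row (b xor q)) ∷ []

  zigzagZones-cover : (c b : Bool) (m : ℕ) (q : Bool) → odd m ≡ q → Covers (+ zigzagWidth c m) (zigzagZones c b q) (zigzagRun c b (suc m))
  zigzagZones-cover c b m q odd-m u∈ with ∈-zigzagRun⁻ {c} {b} {suc m} u∈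
  ... | zero          , _   , refl = here (cong₂ _,_ (cong +_ (NP.+-identityʳ (bit c))) refl)
  ... | suc zero      , _   , refl = there (here refl)
  ... | suc (suc t)   , t<  , refl with m ℕ.≟ suc (suc t)
  ...   | yes refl = there (there (there (there (here (cong₂ _,_ (sym (+[a+k]-+k≡+a _ (bit c))) (cong (λ o → row (b xor o)) odd-m))))))
  ...   | no m≢t+2 with m ℕ.≟ suc (suc (suc t))
  ...     | yes refl = there (there (there (here (cong₂ _,_ x≡ (cong (λ o → row (b xor o)) (odd-pred (suc (suc t)) q odd-m))))))
    where
    x≡ : + (bit c ℕ.+ 2 ℕ.* suc (suc t)) ≡ + zigzagWidth c (suc (suc (suc t))) - + (2 ℕ.+ bit c)
    x≡ = sym (trans (cong (λ z → + z - + (2 ℕ.+ bit c)) (width-split (bit c) t)) (+[a+k]-+k≡+a _ (2 ℕ.+ bit c)))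
      where
      width-split : ∀ x t → x ℕ.+ 2 ℕ.* suc (suc (suc t)) ℕ.+ x ≡ x ℕ.+ 2 ℕ.* suc (suc t) ℕ.+ (2 ℕ.+ x)
      width-split = NS.solve-∀
  ...     | no m≢t+3 = there (there (here ((+≤+ 4≤x , +a≤+n-+k x+4≤R) , row-bounds _)))
    where
    t+4≤m : suc (suc (suc (suc t))) ℕ.≤ m
    t+4≤m = NP.≤∧≢⇒< (NP.≤∧≢⇒< (NP.≤-pred t<) (m≢t+2 ∘ sym)) (m≢t+3 ∘ sym)
    4≤x : 4 ℕ.≤ bit c ℕ.+ 2 ℕ.* suc (suc t)
    4≤x = NP.≤-trans (NP.m≤m+n 4 (2 ℕ.* t)) (NP.≤-trans (NP.≤-reflexive (4+2t (bit c) t)) (NP.m≤n+m _ (bit c)))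
      where
      4+2t : ∀ x t → 4 ℕ.+ 2 ℕ.* t ≡ 2 ℕ.* suc (suc t)
      4+2t _ = NS.solve-∀
    x+4≤R : bit c ℕ.+ 2 ℕ.* suc (suc t) ℕ.+ 4 ℕ.≤ zigzagWidth c m
    x+4≤R = NP.≤-trans (NP.≤-reflexive (x+4 (bit c) t))
              (NP.≤-trans (NP.+-monoʳ-≤ (bit c) (NP.*-monoʳ-≤ 2 t+4≤m)) (NP.m≤m+n _ (bit c)))
      where
      x+4 : ∀ x t → x ℕ.+ 2 ℕ.* suc (suc t) ℕ.+ 4 ≡ x ℕ.+ 2 ℕ.* suc (suc (suc (suc t)))
      x+4 = NS.solve-∀

  zigzagBlock : (c b : Bool) (m : ℕ) (q : Bool) → odd m ≡ q → Block (+ zigzagWidth c m)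
  zigzagBlock c b m q odd-m = record
    { start    = (left (+ bit c) , row (b xor false))
    ; end      = (right (- + bit c) , row (b xor q))
    ; cells    = zigzagRun c b (suc m)
    ; path     = subst₂ (λ u v → InducedPath u v (zigzagRun c b (suc m))) first≡ last≡ (zigzagRun-path c b m)
    ; zones    = zigzagZones c b q
    ; covers   = zigzagZones-cover c b m q odd-m
    ; class    = just (c , b)
    ; in-class = λ u∈ → let t , _ , u≡ = ∈-zigzagRun⁻ {c} {b} {suc m} u∈ in t , u≡
    }
    where
    first≡ : zigzag c b 0 ≡ (+ bit c , row (b xor false))
    first≡ = cong₂ _,_ (cong +_ (NP.+-identityʳ (bit c))) refl
    last≡ : zigzag c b m ≡ (+ zigzagWidth c m - + bit c , row (b xor q))
    last≡ = cong₂ _,_ (sym (+[a+k]-+k≡+a _ (bit c))) (cong (λ o → row (b xor o)) odd-m)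

  -- For small widths the symbolic box may be too coarse; list every cell instead.
  zigzagPoints : Bool → Bool → ℕ → List Zone
  zigzagPoints c b n = applyUpTo (λ t → point (left (+ (bit c ℕ.+ 2 ℕ.* t))) (row (b xor odd t))) n

  zigzagPoints-cover : ∀ {R} c b n → Covers R (zigzagPoints c b n) (zigzagRun c b n)
  zigzagPoints-cover c b n u∈ with ∈-zigzagRun⁻ {c} {b} {n} u∈
  ... | t , t<n , refl = lose (∈-applyUpTo⁺ (λ t → point (left (+ (bit c ℕ.+ 2 ℕ.* t))) (row (b xor odd t))) t<n) refl

  zigzagPointsBlock : (c b : Bool) (m : ℕ) (q : Bool) → odd m ≡ q → Block (+ zigzagWidth c m)
  zigzagPointsBlock c b m q odd-m = record (zigzagBlock c b m q odd-m)
    { zones = zigzagPoints c b (suc m) ; covers = zigzagPoints-cover c b (suc m) }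

  -- Levels

  -- Unlike concat it does not end in ++ [], so that it agrees definitionally with chainCells.
  concat₁ : List (List Cell) → List Cell
  concat₁ []            = []
  concat₁ (b ∷ [])      = b
  concat₁ (b ∷ b′ ∷ bs) = b ++ concat₁ (b′ ∷ bs)

  ∈-concat₁⁻ : ∀ bs {x} → x ∈ concat₁ bs → ∃ λ b → b ∈ bs × x ∈ b
  ∈-concat₁⁻ (b ∷ [])      x∈ = b , here refl , x∈
  ∈-concat₁⁻ (b ∷ b′ ∷ bs) x∈ =
    Sum.[ (λ x∈b → b , here refl , x∈b)
        , (λ x∈bs → let b″ , b″∈ , x∈b″ = ∈-concat₁⁻ (b′ ∷ bs) x∈bs in b″ , there b″∈ , x∈b″) ]′ (∈-++⁻ b x∈)

  ∈-concat₁⁺ : ∀ bs {b x} → b ∈ bs → x ∈ b → x ∈ concat₁ bs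
  ∈-concat₁⁺ (b ∷ [])      (here refl) x∈ = x∈
  ∈-concat₁⁺ (b ∷ b′ ∷ bs) (here refl) x∈ = ∈-++⁺ˡ x∈
  ∈-concat₁⁺ (b ∷ b′ ∷ bs) (there b∈)  x∈ = ∈-++⁺ʳ b (∈-concat₁⁺ (b′ ∷ bs) b∈ x∈)

  -- The path through a twine of half-width h is described by a layout: a list of pieces in path order.
  data Piece : Set where
    run runᴿ : Bool → Bool → Piece
    single   : SymCell → Piece
    upper    : Piece

  runLength : Bool → ℕ → ℕ
  runLength true  h = h
  runLength false h = suc h

  ⟦_⟧ : Piece → ℤ → ℕ → List Cell → List Cell
  ⟦ run c b    ⟧ R h Q = zigzagRun c b (runLength c h)
  ⟦ runᴿ c b   ⟧ R h Q = reverse (zigzagRun c b (runLength c h))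
  ⟦ single p   ⟧ R h Q = cellAt R p ∷ []
  ⟦ upper      ⟧ R h Q = reverse (map (flipUp R) Q)

  pieces : ℤ → ℕ → List Cell → List Piece → List Cell
  pieces R h Q ℓ = concat₁ (map (λ pc → ⟦ pc ⟧ R h Q) ℓ)

  -- In the frame of the twine below, this cell is the top cell (0, 6) of the splice joining the two twines.
  lowerSpliceTop : SymCell
  lowerSpliceTop = (left (- + 1) , + 2)

  -- The splice to the twine above, in two halves: up to the flipped upper level and back down.
  spliceUp spliceDown : List Piece
  spliceUp   = single (right (+ 1) , + 1) ∷ single (right (+ 2) , + 3) ∷ single (right (+ 3) , + 5) ∷ single (right (+ 1) , + 6) ∷ []
  spliceDown = single (right (+ 0) , + 5) ∷ single (right (+ 2) , + 6) ∷ single (right (+ 3) , + 4) ∷ single (right (+ 2) , + 2) ∷ []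

  -- The Boolean is the parity of the half-widths, which decides where the path turns.
  topLayout : Bool → List Piece
  topLayout true =
    run true false ∷ single (right (+ 1) , + 1) ∷ single (right (+ 0) , + 3) ∷ runᴿ true true ∷ single lowerSpliceTop ∷
    run false false ∷ single (right (+ 1) , + 3) ∷ single (right (+ 2) , + 1) ∷ runᴿ false true ∷ []
  topLayout false =
    run true false ∷ single (right (+ 0) , + 3) ∷ single (right (+ 1) , + 1) ∷ runᴿ true true ∷ single lowerSpliceTop ∷
    run false false ∷ single (right (+ 2) , + 1) ∷ single (right (+ 1) , + 3) ∷ runᴿ false true ∷ []

  middleLayout : Bool → List Piece
  middleLayout true =
    run true false ∷ spliceUp ++ upper ∷ spliceDown ++
    runᴿ false false ∷ single lowerSpliceTop ∷ run true true ∷ single (right (+ 1) , + 2) ∷ runᴿ false true ∷ []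
  middleLayout false =
    run true false ∷ single (right (+ 1) , + 2) ∷ runᴿ false false ∷ single lowerSpliceTop ∷ run true true ∷
    spliceUp ++ upper ∷ spliceDown ++ runᴿ false true ∷ []

  bottomLayout : Bool → List Piece
  bottomLayout true =
    single (left (- + 1) , + 3) ∷ run false true ∷ single (right (+ 1) , + 2) ∷ runᴿ true true ∷
    single (left (+ 0) , + 3) ∷ single (left (- + 1) , + 1) ∷ run true false ∷
    spliceUp ++ upper ∷ spliceDown ++ runᴿ false false ∷ []
  bottomLayout false =
    single (left (- + 2) , + 1) ∷ run false false ∷ single (right (+ 1) , + 2) ∷ runᴿ true false ∷
    single (left (- + 1) , + 1) ∷ single (left (+ 0) , + 3) ∷ run true true ∷
    spliceUp ++ upper ∷ spliceDown ++ runᴿ false true ∷ []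

  -- The cell of the tie-off that closes the bottom path into a cycle.
  bottomApex : Bool → SymCell
  bottomApex true  = (left (- + 2) , + 1)
  bottomApex false = (left (- + 1) , + 3)

  levelZones : List Zone
  levelZones =
    point (left (- + 1)) (+ 2) ∷ point (left (+ 0)) (+ 0) ∷ point (left (+ 0)) (+ 1) ∷ point (left (+ 1)) (+ 0) ∷
    point (left (+ 1)) (+ 1) ∷ column (left (+ 2)) (right (+ 3)) (+ 0) ∷ []

  -- A level of width R: an induced path from (1, 0) to (0, 1) through the twine and everything above it,
  -- which stays clear of the cells left of the twine except for lowerSpliceTop.
  IsLevel : ℤ → List Cell → Set
  IsLevel R L = InducedPath (cellAt R (left (+ 1) , + 0)) (cellAt R (left (+ 0) , + 1)) L × Covers R levelZones L

  ChainLevel : ∀ {R} → Block R × List (Block R) → Set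
  ChainLevel {R} (B , Bs) =
    InducedPath (cellAt R (start B)) (cellAt R (chainEnd B Bs)) (chainCells B Bs) × Covers R levelZones (chainCells B Bs)

  chain-level : ∀ {R₀ R} → R₀ ≤ R → (BBs : Block R × List (Block R)) → T (chainᵇ R₀ (proj₁ BBs) (proj₂ BBs)) →
                T (all (λ B → zones⊆ᵇ R₀ (zones B) levelZones) (proj₁ BBs ∷ proj₂ BBs)) → ChainLevel BBs
  chain-level R₀≤R (B , Bs) t-chain t-zones = chain-path R₀≤R B Bs t-chain , chain-covers R₀≤R levelZones B Bs t-zones

  castBlock : ∀ {R R′} → R ≡ R′ → Block R → Block R′
  castBlock R≡R′ B = record
    { start = start B ; end = end B ; cells = cells B
    ; path   = subst (λ R → InducedPath (cellAt R (start B)) (cellAt R (end B)) (cells B)) R≡R′ (path B)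
    ; zones = zones B
    ; covers = subst (λ R → Covers R (zones B) (cells B)) R≡R′ (covers B)
    ; class = class B ; in-class = in-class B
    }

  odd-3+ : ∀ h p → odd h ≡ p → odd (3 ℕ.+ h) ≡ not p
  odd-3+ h p e = cong not (trans (BP.not-involutive _) e)

  odd-4+ : ∀ h p → odd h ≡ p → odd (4 ℕ.+ h) ≡ p
  odd-4+ h p e = trans (BP.not-involutive _) (trans (BP.not-involutive _) e)

  private
    10≤R′+8 : ∀ {h′ R′} → R′ ≡ + (2 ℕ.* h′) → 1 ℕ.≤ h′ → + 10 ≤ R′ + + 8
    10≤R′+8 {suc h} refl _ = subst (+ 10 ≤_) (ℤP.pos-+ (2 ℕ.* suc h) 8)
      (+≤+ (NP.+-monoˡ-≤ 8 (NP.≤-trans (s≤s (s≤s z≤n)) (NP.≤-reflexive (sym (NP.*-suc 2 h))))))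

  module _ {h′ : ℕ} {R′ : ℤ} (R′≡2h′ : R′ ≡ + (2 ℕ.* h′)) (h′≥1 : 1 ℕ.≤ h′) where
    private
      R = R′ + + 8

      10≤R : + 10 ≤ R
      10≤R = 10≤R′+8 R′≡2h′ h′≥1

      width-odd : + zigzagWidth true (3 ℕ.+ h′) ≡ R
      width-odd = trans (cong +_ (2+2[3+h]≡2h+8 h′)) (trans (ℤP.pos-+ (2 ℕ.* h′) 8) (cong (_+ + 8) (sym R′≡2h′)))
        where
        2+2[3+h]≡2h+8 : ∀ h → 1 ℕ.+ 2 ℕ.* (3 ℕ.+ h) ℕ.+ 1 ≡ 2 ℕ.* h ℕ.+ 8
        2+2[3+h]≡2h+8 = NS.solve-∀

      width-even : + zigzagWidth false (4 ℕ.+ h′) ≡ R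
      width-even = trans (cong +_ (2[4+h]≡2h+8 h′)) (trans (ℤP.pos-+ (2 ℕ.* h′) 8) (cong (_+ + 8) (sym R′≡2h′)))
        where
        2[4+h]≡2h+8 : ∀ h → 0 ℕ.+ 2 ℕ.* (4 ℕ.+ h) ℕ.+ 0 ≡ 2 ℕ.* h ℕ.+ 8
        2[4+h]≡2h+8 = NS.solve-∀

      oddRun : ∀ b {q} → odd (3 ℕ.+ h′) ≡ q → Block R
      oddRun b {q} odd-q = castBlock width-odd (zigzagBlock true b (3 ℕ.+ h′) q odd-q)

      evenRun : ∀ b {q} → odd (4 ℕ.+ h′) ≡ q → Block R
      evenRun b {q} odd-q = castBlock width-even (zigzagBlock false b (4 ℕ.+ h′) q odd-q)

      splice : ∀ {Q} → IsLevel R′ Q → List (Block R) → List (Block R)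
      splice (Q-path , Q-covers) rest =
        pointBlock R (right (+ 1) , + 1) ∷ pointBlock R (right (+ 2) , + 3) ∷ pointBlock R (right (+ 3) , + 5) ∷
        pointBlock R (right (+ 1) , + 6) ∷ flippedBlock R′ _ levelZones Q-path Q-covers ∷
        pointBlock R (right (+ 0) , + 5) ∷ pointBlock R (right (+ 2) , + 6) ∷ pointBlock R (right (+ 3) , + 4) ∷
        pointBlock R (right (+ 2) , + 2) ∷ rest

    middleLevel : ∀ p → odd h′ ≡ p → ∀ {Q} → IsLevel R′ Q → IsLevel R (pieces R (4 ℕ.+ h′) Q (middleLayout p))
    middleLevel true odd-h′ Q-level = chain-level 10≤R (B , Bs) tt tt
      where
      B : Block R
      B = oddRun false (odd-3+ h′ true odd-h′)
      Bs : List (Block R)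
      Bs = splice Q-level
             (reverseBlock (evenRun false (odd-4+ h′ true odd-h′)) ∷ pointBlock R lowerSpliceTop ∷
              oddRun true (odd-3+ h′ true odd-h′) ∷ pointBlock R (right (+ 1) , + 2) ∷
              reverseBlock (evenRun true (odd-4+ h′ true odd-h′)) ∷ [])
    middleLevel false odd-h′ Q-level = chain-level 10≤R (B , Bs) tt tt
      where
      B : Block R
      B = oddRun false (odd-3+ h′ false odd-h′)
      Bs : List (Block R)
      Bs = pointBlock R (right (+ 1) , + 2) ∷ reverseBlock (evenRun false (odd-4+ h′ false odd-h′)) ∷
           pointBlock R lowerSpliceTop ∷ oddRun true (odd-3+ h′ false odd-h′) ∷
           splice Q-level (reverseBlock (evenRun true (odd-4+ h′ false odd-h′)) ∷ [])

    bottomCycle : ∀ p → odd h′ ≡ p → ∀ {Q} → IsLevel R′ Q →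
      ∃₂ λ c b → InducedCycle (cellAt R (bottomApex p)) c b (pieces R (4 ℕ.+ h′) Q (bottomLayout p))
    bottomCycle true odd-h′ Q-level =
      _ , _ , chain-cycle 10≤R (bottomApex true) B Bs tt tt tt tt (s≤s (s≤s z≤n))
      where
      B : Block R
      B = pointBlock R (left (- + 1) , + 3)
      Bs : List (Block R)
      Bs = evenRun true (odd-4+ h′ true odd-h′) ∷ pointBlock R (right (+ 1) , + 2) ∷
           reverseBlock (oddRun true (odd-3+ h′ true odd-h′)) ∷ pointBlock R (left (+ 0) , + 3) ∷
           pointBlock R (left (- + 1) , + 1) ∷ oddRun false (odd-3+ h′ true odd-h′) ∷
           splice Q-level (reverseBlock (evenRun false (odd-4+ h′ true odd-h′)) ∷ [])
    bottomCycle false odd-h′ Q-level =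
      _ , _ , chain-cycle 10≤R (bottomApex false) B Bs tt tt tt tt (s≤s (s≤s z≤n))
      where
      B : Block R
      B = pointBlock R (left (- + 2) , + 1)
      Bs : List (Block R)
      Bs = evenRun false (odd-4+ h′ false odd-h′) ∷ pointBlock R (right (+ 1) , + 2) ∷
           reverseBlock (oddRun false (odd-3+ h′ false odd-h′)) ∷ pointBlock R (left (- + 1) , + 1) ∷
           pointBlock R (left (+ 0) , + 3) ∷ oddRun true (odd-3+ h′ false odd-h′) ∷
           splice Q-level (reverseBlock (evenRun true (odd-4+ h′ false odd-h′)) ∷ [])

  private
    10≤2[5+g] : ∀ g → + 10 ≤ + (2 ℕ.* suc (suc (suc (suc (suc g)))))
    10≤2[5+g] g = +≤+ (NP.≤-trans (NP.m≤m+n 10 (2 ℕ.* g)) (NP.≤-reflexive (10+2g≡2[5+g] g)))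
      where
      10+2g≡2[5+g] : ∀ g → 10 ℕ.+ 2 ℕ.* g ≡ 2 ℕ.* suc (suc (suc (suc (suc g))))
      10+2g≡2[5+g] = NS.solve-∀

    absolute : ℤ → Abscissa → Abscissa
    absolute R (left a)  = left a
    absolute R (right a) = left (R + a)

    abscissa-absolute : ∀ R x → abscissa R (absolute R x) ≡ abscissa R x
    abscissa-absolute R (left a)  = refl
    abscissa-absolute R (right a) = refl

    absoluteZone : ℤ → Zone → Zone
    absoluteZone R (point x y)       = point (absolute R x) y
    absoluteZone R (box xl xh yl yh) = box (absolute R xl) (absolute R xh) yl yh
    absoluteZone R (column xl xh yl) = column (absolute R xl) (absolute R xh) yl

    absoluteZone-sound : ∀ R z {u} → InZone R z u → InZone R (absoluteZone R z) u
    absoluteZone-sound R (point (left _) _)  u∈ = u∈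
    absoluteZone-sound R (point (right _) _) u∈ = u∈
    absoluteZone-sound R (box xl xh _ _) ((xl≤ , ≤xh) , y∈) =
      (subst (_≤ _) (sym (abscissa-absolute R xl)) xl≤ , subst (_ ≤_) (sym (abscissa-absolute R xh)) ≤xh) , y∈
    absoluteZone-sound R (column xl xh _) ((xl≤ , ≤xh) , y∈) =
      (subst (_≤ _) (sym (abscissa-absolute R xl)) xl≤ , subst (_ ≤_) (sym (abscissa-absolute R xh)) ≤xh) , y∈

    cellAt-absolute : ∀ R p → cellAt R (absolute R (proj₁ p) , proj₂ p) ≡ cellAt R p
    cellAt-absolute R (x , y) = cong (_, y) (abscissa-absolute R x)

  -- For a concrete width R, every symbolic abscissa can be read from the left end.
  absoluteBlock : ∀ R → Block R → Block R
  absoluteBlock R B = record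
    { start    = (absolute R (proj₁ (start B)) , proj₂ (start B))
    ; end      = (absolute R (proj₁ (end B)) , proj₂ (end B))
    ; cells    = cells B
    ; path     = subst₂ (λ a b → InducedPath a b (cells B)) (sym (cellAt-absolute R (start B))) (sym (cellAt-absolute R (end B))) (path B)
    ; zones    = map (absoluteZone R) (zones B)
    ; covers   = AnyP.map⁺ ∘ Any.map (absoluteZone-sound R _) ∘ covers B
    ; class    = class B
    ; in-class = in-class B
    }

  module _ (g₁ : ℕ) where
    private
      h = suc g₁
      R = + (2 ℕ.* h)

      width-odd : + zigzagWidth true g₁ ≡ R
      width-odd = cong +_ (2+2g≡2[1+g] g₁)
        where
        2+2g≡2[1+g] : ∀ g → 1 ℕ.+ 2 ℕ.* g ℕ.+ 1 ≡ 2 ℕ.* suc g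
        2+2g≡2[1+g] = NS.solve-∀

      width-even : + zigzagWidth false h ≡ R
      width-even = cong +_ (NP.+-identityʳ (2 ℕ.* h))

      runBlock : (small c b : Bool) (m : ℕ) (q : Bool) → odd m ≡ q → Block (+ zigzagWidth c m)
      runBlock false = zigzagBlock
      runBlock true  = zigzagPointsBlock

      normalise : (small : Bool) → Block R → Block R
      normalise false B = B
      normalise true  B = absoluteBlock R B

      oddRun : ∀ small b {p} → odd h ≡ p → Block R
      oddRun small b {p} odd-h = castBlock width-odd (runBlock small true b g₁ (not p) (odd-pred g₁ p odd-h))

      evenRun : ∀ small b {p} → odd h ≡ p → Block R
      evenRun small b {p} odd-h = castBlock width-even (runBlock small false b h p odd-h)

      tieOff : Bool → List (Block R) → List (Block R)
      tieOff true  rest = pointBlock R (right (+ 1) , + 1) ∷ pointBlock R (right (+ 0) , + 3) ∷ rest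
      tieOff false rest = pointBlock R (right (+ 0) , + 3) ∷ pointBlock R (right (+ 1) , + 1) ∷ rest

      tieBack : Bool → List (Block R) → List (Block R)
      tieBack true  rest = pointBlock R (right (+ 1) , + 3) ∷ pointBlock R (right (+ 2) , + 1) ∷ rest
      tieBack false rest = pointBlock R (right (+ 2) , + 1) ∷ pointBlock R (right (+ 1) , + 3) ∷ rest

    topBlocks : (small : Bool) → ∀ p → odd h ≡ p → Block R × List (Block R)
    topBlocks small p odd-h =
      normalise small (oddRun small false odd-h) ,
      map (normalise small)
        (tieOff p (reverseBlock (oddRun small true odd-h) ∷ pointBlock R lowerSpliceTop ∷ evenRun small false odd-h ∷
                   tieBack p (reverseBlock (evenRun small true odd-h) ∷ [])))

  -- Up to half-width 4 the twine is too narrow for the symbolic zones, and the checks are run concretely.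
  topLevel : ∀ g₁ p → odd (suc g₁) ≡ p → IsLevel (+ (2 ℕ.* suc g₁)) (pieces (+ (2 ℕ.* suc g₁)) (suc g₁) [] (topLayout p))
  topLevel 0 true  odd-h = chain-level ℤP.≤-refl (topBlocks 0 true true odd-h) tt tt
  topLevel 1 false odd-h = chain-level ℤP.≤-refl (topBlocks 1 true false odd-h) tt tt
  topLevel 2 true  odd-h = chain-level ℤP.≤-refl (topBlocks 2 true true odd-h) tt tt
  topLevel 3 false odd-h = chain-level ℤP.≤-refl (topBlocks 3 true false odd-h) tt tt
  topLevel (suc (suc (suc (suc g)))) true  odd-h = chain-level (10≤2[5+g] g) (topBlocks _ false true odd-h) tt tt
  topLevel (suc (suc (suc (suc g)))) false odd-h = chain-level (10≤2[5+g] g) (topBlocks _ false false odd-h) tt tt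
  topLevel 0 false ()
  topLevel 1 true  ()
  topLevel 2 false ()
  topLevel 3 true  ()

  halfWidth : ℕ → ℕ → ℕ
  halfWidth zero    g = g
  halfWidth (suc m) g = 4 ℕ.+ halfWidth m g

  -- Width of the twine m levels below a top twine of half-width g; recursive so that it is R′ + 8 definitionally.
  width : ℕ → ℕ → ℤ
  width zero    g = + (2 ℕ.* g)
  width (suc m) g = width m g + + 8

  width≡ : ∀ m g → width m g ≡ + (2 ℕ.* halfWidth m g)
  width≡ zero    g = refl
  width≡ (suc m) g = trans (cong (_+ + 8) (width≡ m g)) (trans (sym (ℤP.pos-+ (2 ℕ.* halfWidth m g) 8)) (cong +_ (2h+8≡2[4+h] (halfWidth m g))))
    where
    2h+8≡2[4+h] : ∀ h → 2 ℕ.* h ℕ.+ 8 ≡ 2 ℕ.* (4 ℕ.+ h)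
    2h+8≡2[4+h] = NS.solve-∀

  odd-halfWidth : ∀ m g → odd (halfWidth m g) ≡ odd g
  odd-halfWidth zero    g = refl
  odd-halfWidth (suc m) g = odd-4+ (halfWidth m g) (odd g) (odd-halfWidth m g)

  halfWidth≥1 : ∀ m g → 1 ℕ.≤ g → 1 ℕ.≤ halfWidth m g
  halfWidth≥1 zero    g g≥1 = g≥1
  halfWidth≥1 (suc m) g _   = s≤s z≤n

  level : Bool → ℕ → ℕ → List Cell
  level p zero    zero     = []
  level p zero    (suc g₁) = pieces (+ (2 ℕ.* suc g₁)) (suc g₁) [] (topLayout p)
  level p (suc m) g        = pieces (width (suc m) g) (halfWidth (suc m) g) (level p m g) (middleLayout p)

  level-valid : ∀ p m g → odd g ≡ p → 1 ℕ.≤ g → IsLevel (width m g) (level p m g)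
  level-valid p zero    (suc g₁) odd-g _   = topLevel g₁ p odd-g
  level-valid p (suc m) g        odd-g g≥1 =
    middleLevel (width≡ m g) (halfWidth≥1 m g g≥1) p (trans (odd-halfWidth m g) odd-g) (level-valid p m g odd-g g≥1)

  bottomCells : Bool → ℕ → ℕ → List Cell
  bottomCells p k₀ g = pieces (width (suc k₀) g) (halfWidth (suc k₀) g) (level p k₀ g) (bottomLayout p)

  bottom-cycle : ∀ p k₀ g → odd g ≡ p → 1 ℕ.≤ g →
    ∃₂ λ c b → InducedCycle (cellAt (width (suc k₀) g) (bottomApex p)) c b (bottomCells p k₀ g)
  bottom-cycle p k₀ g odd-g g≥1 =
    bottomCycle (width≡ k₀ g) (halfWidth≥1 k₀ g g≥1) p (trans (odd-halfWidth k₀ g) odd-g) (level-valid p k₀ g odd-g g≥1)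

  -- Placing the levels on U(k, I)

  InTwineFrame : ℤ → Cell → Set
  InTwineFrame R (a , y) = (+ 0 ≤ a × a ≤ R) × (+ 0 ≤ y × y ≤ + 1)

  InZigzags : ℕ → Cell → Set
  InZigzags h u = ∃₂ λ c b → u ∈ zigzagRun c b (runLength c h)

  private
    zigzag-x≤ : ∀ c h {t} → t < runLength c h → bit c ℕ.+ 2 ℕ.* t ℕ.≤ 2 ℕ.* h
    zigzag-x≤ false h t<1+h = NP.*-monoʳ-≤ 2 (NP.≤-pred t<1+h)
    zigzag-x≤ true  h {t} t<h =
      NP.≤-trans (NP.n≤1+n _) (subst (ℕ._≤ 2 ℕ.* h) (NP.*-suc 2 t) (NP.*-monoʳ-≤ 2 t<h))

    zigzag-t< : ∀ c h {t} → bit c ℕ.+ 2 ℕ.* t ℕ.≤ 2 ℕ.* h → t < runLength c h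
    zigzag-t< false h 2t≤2h = s≤s (NP.*-cancelˡ-≤ 2 2t≤2h)
    zigzag-t< true  h 1+2t≤2h = NP.*-cancelˡ-< 2 _ _ (NP.<-≤-trans (NP.n<1+n _) 1+2t≤2h)

    row-surjective : ∀ {y} → + 0 ≤ y → y ≤ + 1 → ∃ λ b → y ≡ row b
    row-surjective {+ 0}           _ _ = false , refl
    row-surjective {+ 1}           _ _ = true , refl
    row-surjective {+ suc (suc _)} _ (+≤+ (s≤s ()))

    xor-cancelʳ : ∀ a o → (a xor o) xor o ≡ a
    xor-cancelʳ false false = refl
    xor-cancelʳ false true  = refl
    xor-cancelʳ true  false = refl
    xor-cancelʳ true  true  = refl

  zigzags⊆twine : ∀ h {u} → InZigzags h u → InTwineFrame (+ (2 ℕ.* h)) u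
  zigzags⊆twine h (c , b , u∈) with ∈-zigzagRun⁻ {c} {b} u∈
  ... | t , t< , refl = (+≤+ z≤n , +≤+ (zigzag-x≤ c h t<)) , row-bounds _

  twine⊆zigzags : ∀ h {u} → InTwineFrame (+ (2 ℕ.* h)) u → InZigzags h u
  twine⊆zigzags h {+ x , y} ((_ , +≤+ x≤2h) , (0≤y , y≤1)) with row-surjective 0≤y y≤1 | bit+2*-surjective x
  ... | b , refl | c , t , refl =
    c , b xor odd t ,
    subst (_∈ zigzagRun c (b xor odd t) (runLength c h)) (cong (λ b′ → (+ (bit c ℕ.+ 2 ℕ.* t) , row b′)) (xor-cancelʳ b (odd t)))
      (∈-applyUpTo⁺ (zigzag c (b xor odd t)) (zigzag-t< c h {t} x≤2h))

  fromLeft fromRight : Cell → SymCell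
  fromLeft  (a , y) = (left a , y)
  fromRight (a , y) = (right a , y)

  module _ {R : ℤ} {h : ℕ} {Q : List Cell} where
    ∈-pieces⁻ : ∀ ℓ {x} → x ∈ pieces R h Q ℓ → ∃ λ pc → pc ∈ ℓ × x ∈ ⟦ pc ⟧ R h Q
    ∈-pieces⁻ ℓ x∈ with ∈-concat₁⁻ (map _ ℓ) x∈
    ... | b , b∈ , x∈b with ∈-map⁻ _ b∈
    ... | pc , pc∈ , refl = pc , pc∈ , x∈b

    ∈-pieces⁺ : ∀ ℓ {pc x} → pc ∈ ℓ → x ∈ ⟦ pc ⟧ R h Q → x ∈ pieces R h Q ℓ
    ∈-pieces⁺ ℓ pc∈ = ∈-concat₁⁺ (map _ ℓ) (∈-map⁺ _ pc∈)

  singleWithinᵇ : List SymCell → Piece → Bool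
  singleWithinᵇ ps (single p) = any (λ p′ → ⌊ p ≟ₛ p′ ⌋) ps
  singleWithinᵇ ps _          = true

  hasRunᵇ : Bool → Bool → Piece → Bool
  hasRunᵇ c b (run c′ b′)  = ⌊ c BP.≟ c′ ⌋ ∧ ⌊ b BP.≟ b′ ⌋
  hasRunᵇ c b (runᴿ c′ b′) = ⌊ c BP.≟ c′ ⌋ ∧ ⌊ b BP.≟ b′ ⌋
  hasRunᵇ _ _ _            = false

  hasSingleᵇ : SymCell → Piece → Bool
  hasSingleᵇ p (single p′) = ⌊ p ≟ₛ p′ ⌋
  hasSingleᵇ _ _           = false

  hasUpperᵇ : Piece → Bool
  hasUpperᵇ upper = true
  hasUpperᵇ _     = false

  allRunsᵇ : List Piece → Bool
  allRunsᵇ ℓ = all (λ c → all (λ b → any (hasRunᵇ c b) ℓ) (true ∷ false ∷ [])) (true ∷ false ∷ [])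

  Exception : Maybe Cell → Cell → Set
  Exception nothing  d = ⊥
  Exception (just e) d = d ≡ e

  isExceptionᵇ : Maybe Cell → Cell → Bool
  isExceptionᵇ nothing  _ = false
  isExceptionᵇ (just e) d = ⌊ d ≟ᶜ e ⌋

  offsetsPresentᵇ : (Cell → SymCell) → Maybe Cell → List Cell → List Piece → Bool
  offsetsPresentᵇ sym e ds ℓ = all (λ d → isExceptionᵇ e d ∨ any (hasSingleᵇ (sym d)) ℓ) ds

  module _ {R : ℤ} {h : ℕ} {Q : List Cell} where
    private
      find-piece : ∀ (f : Piece → Bool) ℓ → T (any f ℓ) → ∃ λ pc → pc ∈ ℓ × T (f pc)
      find-piece f ℓ t = find (AnyP.any⁻ f ℓ t)

      bool∈ : ∀ c → c ∈ true ∷ false ∷ []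
      bool∈ true  = here refl
      bool∈ false = there (here refl)

    ∈-pieces-cases : ∀ ps ℓ → T (all (singleWithinᵇ ps) ℓ) → ∀ {x} → x ∈ pieces R h Q ℓ →
      InZigzags h x ⊎ (∃ λ p → p ∈ ps × x ≡ cellAt R p) ⊎ x ∈ reverse (map (flipUp R) Q)
    ∈-pieces-cases ps ℓ t {x} x∈ with ∈-pieces⁻ ℓ x∈
    ... | pc , pc∈ , x∈pc = cases pc (all-∈ (singleWithinᵇ ps) t pc∈) x∈pc
      where
      cases : ∀ pc → T (singleWithinᵇ ps pc) → x ∈ ⟦ pc ⟧ R h Q →
              InZigzags h x ⊎ (∃ λ p → p ∈ ps × x ≡ cellAt R p) ⊎ x ∈ reverse (map (flipUp R) Q)
      cases (run c b)  _ x∈pc        = inj₁ (c , b , x∈pc)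
      cases (runᴿ c b) _ x∈pc        = inj₁ (c , b , AnyP.reverse⁻ x∈pc)
      cases (single p) t (here refl) = inj₂ (inj₁ (p , Any.map (λ {p′} → toWitness {a? = p ≟ₛ p′}) (AnyP.any⁻ _ ps t) , refl))
      cases upper      _ x∈pc        = inj₂ (inj₂ x∈pc)

    zigzags⊆pieces : ∀ ℓ → T (allRunsᵇ ℓ) → ∀ {x} → InZigzags h x → x ∈ pieces R h Q ℓ
    zigzags⊆pieces ℓ t (c , b , x∈)
      with find-piece (hasRunᵇ c b) ℓ
             (all-∈ (λ b → any (hasRunᵇ c b) ℓ) (all-∈ (λ c → all (λ b → any (hasRunᵇ c b) ℓ) (true ∷ false ∷ [])) t (bool∈ c)) (bool∈ b))
    ... | pc , pc∈ , t-pc = ∈-pieces⁺ ℓ pc∈ (run∈ pc t-pc)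
      where
      run∈ : ∀ pc → T (hasRunᵇ c b pc) → _ ∈ ⟦ pc ⟧ R h Q
      run∈ (run c′ b′) t′ with T-∧⁻ {⌊ c BP.≟ c′ ⌋} t′
      ... | tc , tb with toWitness tc | toWitness tb
      ... | refl | refl = x∈
      run∈ (runᴿ c′ b′) t′ with T-∧⁻ {⌊ c BP.≟ c′ ⌋} t′
      ... | tc , tb with toWitness tc | toWitness tb
      ... | refl | refl = AnyP.reverse⁺ x∈

    single∈pieces : ∀ ℓ p → T (any (hasSingleᵇ p) ℓ) → cellAt R p ∈ pieces R h Q ℓ
    single∈pieces ℓ p t with find-piece (hasSingleᵇ p) ℓ t
    ... | single p′ , pc∈ , t′ with toWitness {a? = p ≟ₛ p′} t′
    ... | refl = ∈-pieces⁺ ℓ pc∈ (here refl)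

    offset∈pieces : ∀ sym e ds ℓ → T (offsetsPresentᵇ sym e ds ℓ) → ∀ {d} → d ∈ ds →
                    Exception e d ⊎ cellAt R (sym d) ∈ pieces R h Q ℓ
    offset∈pieces sym nothing ds ℓ t {d} d∈ =
      inj₂ (single∈pieces ℓ (sym d) (all-∈ (λ d → any (hasSingleᵇ (sym d)) ℓ) t d∈))
    offset∈pieces sym (just e) ds ℓ t {d} d∈
      with T-∨⁻ {⌊ d ≟ᶜ e ⌋} (all-∈ (λ d → ⌊ d ≟ᶜ e ⌋ ∨ any (hasSingleᵇ (sym d)) ℓ) t d∈)
    ... | inj₁ t-e = inj₁ (toWitness t-e)
    ... | inj₂ t-d = inj₂ (single∈pieces ℓ (sym d) t-d)

    upper⊆pieces : ∀ ℓ → T (any hasUpperᵇ ℓ) → ∀ {x} → x ∈ reverse (map (flipUp R) Q) → x ∈ pieces R h Q ℓ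
    upper⊆pieces ℓ t x∈ with find-piece hasUpperᵇ ℓ t
    ... | upper , pc∈ , _ = ∈-pieces⁺ ℓ pc∈ x∈

  bottomApexOffset : Bool → Cell
  bottomApexOffset p = cellAt (+ 0) (bottomApex p)

  record LayoutChecks (singles : List SymCell) (ℓ : List Piece) : Set where
    field
      singles-within : T (all (singleWithinᵇ singles) ℓ)
      runs-present   : T (allRunsᵇ ℓ)

  record TopChecks (ℓ : List Piece) : Set where
    field
      layout          : LayoutChecks (map fromRight tieRightOffsets ++ lowerSpliceTop ∷ []) ℓ
      ties-present    : T (offsetsPresentᵇ fromRight nothing tieRightOffsets ℓ)
      top-present     : T (any (hasSingleᵇ lowerSpliceTop) ℓ)

  record MiddleChecks (ℓ : List Piece) : Set where
    field
      layout          : LayoutChecks (map fromRight spliceRightOffsets ++ lowerSpliceTop ∷ []) ℓ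
      splices-present : T (offsetsPresentᵇ fromRight (just (+ 0 , + 6)) spliceRightOffsets ℓ)
      top-present     : T (any (hasSingleᵇ lowerSpliceTop) ℓ)
      upper-present   : T (any hasUpperᵇ ℓ)

  record BottomChecks (apex : Cell) (ℓ : List Piece) : Set where
    field
      layout          : LayoutChecks (map fromRight spliceRightOffsets ++ map fromLeft tieLeftOffsets) ℓ
      splices-present : T (offsetsPresentᵇ fromRight (just (+ 0 , + 6)) spliceRightOffsets ℓ)
      ties-present    : T (offsetsPresentᵇ fromLeft (just apex) tieLeftOffsets ℓ)
      upper-present   : T (any hasUpperᵇ ℓ)

  top-checks : ∀ p → TopChecks (topLayout p)
  top-checks true  = _
  top-checks false = _

  middle-checks : ∀ p → MiddleChecks (middleLayout p)
  middle-checks true  = _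
  middle-checks false = _

  bottom-checks : ∀ p → BottomChecks (bottomApexOffset p) (bottomLayout p)
  bottom-checks true  = _
  bottom-checks false = _

  mirror : Cell → Cell
  mirror (a , y) = (- a , y)

  private
    isEven-suc : ∀ j → isEven (suc j) ≡ not (isEven j)
    isEven-suc zero    = refl
    isEven-suc (suc j) = trans (sym (BP.not-involutive _)) (cong not (sym (isEven-suc j)))

    halfWidth≡ : ∀ m g → halfWidth m g ≡ 4 ℕ.* m ℕ.+ g
    halfWidth≡ zero    g = refl
    halfWidth≡ (suc m) g = trans (cong (4 ℕ.+_) (halfWidth≡ m g)) (4+[4m+g]≡4[1+m]+g m g)
      where
      4+[4m+g]≡4[1+m]+g : ∀ m g → 4 ℕ.+ (4 ℕ.* m ℕ.+ g) ≡ 4 ℕ.* suc m ℕ.+ g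
      4+[4m+g]≡4[1+m]+g = NS.solve-∀

    halfWidth-+ : ∀ m j g → halfWidth (m ℕ.+ j) g ≡ 4 ℕ.* j ℕ.+ halfWidth m g
    halfWidth-+ m j g = trans (halfWidth≡ (m ℕ.+ j) g) (trans (4[m+j]+g≡4j+[4m+g] m j g) (cong (4 ℕ.* j ℕ.+_) (sym (halfWidth≡ m g))))
      where
      4[m+j]+g≡4j+[4m+g] : ∀ m j g → 4 ℕ.* (m ℕ.+ j) ℕ.+ g ≡ 4 ℕ.* j ℕ.+ (4 ℕ.* m ℕ.+ g)
      4[m+j]+g≡4j+[4m+g] = NS.solve-∀

    baseY-suc : ∀ j → baseY (suc j) ≡ baseY j + + 4
    baseY-suc j = trans (cong +_ (4[1+j]≡4j+4 j)) (ℤP.pos-+ (4 ℕ.* j) 4)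
      where
      4[1+j]≡4j+4 : ∀ j → 4 ℕ.* suc j ≡ 4 ℕ.* j ℕ.+ 4
      4[1+j]≡4j+4 = NS.solve-∀

  -- In its own frame the twine E_j is [0, width m g] × [0, 1], where m = k − 1 − j is its depth below the top.
  module Placement (k₀ g₁ : ℕ) (x′ x″ : ℤ) (x″≡ : x″ ≡ x′ + + (2 ℕ.* halfWidth (suc k₀) (suc g₁))) where

    g : ℕ
    g = suc g₁

    k : ℕ
    k = suc (suc k₀)

    x″-split : ∀ m j → m ℕ.+ j ≡ suc k₀ → x″ ≡ x′ + ((baseY j + baseY j) + width m g)
    x″-split m j m+j≡ = trans x″≡ (cong (λ z → x′ + z) (begin
      + (2 ℕ.* halfWidth (suc k₀) g)                          ≡⟨ cong (λ n → + (2 ℕ.* halfWidth n g)) (sym m+j≡) ⟩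
      + (2 ℕ.* halfWidth (m ℕ.+ j) g)                         ≡⟨ cong (λ h → + (2 ℕ.* h)) (halfWidth-+ m j g) ⟩
      + (2 ℕ.* (4 ℕ.* j ℕ.+ halfWidth m g))                   ≡⟨ cong +_ (2[4j+h]≡8j+2h j (halfWidth m g)) ⟩
      + ((4 ℕ.* j ℕ.+ 4 ℕ.* j) ℕ.+ 2 ℕ.* halfWidth m g)       ≡⟨ ℤP.pos-+ (4 ℕ.* j ℕ.+ 4 ℕ.* j) _ ⟩
      + (4 ℕ.* j ℕ.+ 4 ℕ.* j) + + (2 ℕ.* halfWidth m g)       ≡⟨ cong₂ _+_ (ℤP.pos-+ (4 ℕ.* j) (4 ℕ.* j)) (sym (width≡ m g)) ⟩
      (baseY j + baseY j) + width m g                         ∎))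
      where
      open ≡-Reasoning
      2[4j+h]≡8j+2h : ∀ j h → 2 ℕ.* (4 ℕ.* j ℕ.+ h) ≡ (4 ℕ.* j ℕ.+ 4 ℕ.* j) ℕ.+ 2 ℕ.* h
      2[4j+h]≡8j+2h = NS.solve-∀

    -- Even twines are read from their left end, odd twines (mirrored) from their right end.
    placeX : Bool → ℕ → ℤ → ℤ
    placeX true  j a = leftX x′ j + a
    placeX false j a = rightX x″ j - a

    place : ℕ → Cell → Cell
    place j (a , y) = (placeX (isEven j) j a , baseY j + y)

    place-isometry : ∀ j → KnightIsometry (place j)
    place-isometry j = ∣Δ∣-preserving⇒isometry
      (λ {a} {b} e → cong₂ _,_ (placeX-injective (isEven j) (cong proj₁ e)) (+-cancelˡ (baseY j) (cong proj₂ e)))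
      (λ a b → ∣Δx∣ (isEven j) (proj₁ a) (proj₁ b)) (λ a b → cong ∣_∣ (Δ+ (baseY j) (proj₂ a) (proj₂ b)))
      where
      Δ+ : ∀ L a b → (L + a) - (L + b) ≡ a - b
      Δ+ = solve-∀
      Δ- : ∀ L a b → (L - a) - (L - b) ≡ b - a
      Δ- = solve-∀
      ∣Δx∣ : ∀ e a b → ∣ placeX e j a - placeX e j b ∣ ≡ ∣ a - b ∣
      ∣Δx∣ true  a b = cong ∣_∣ (Δ+ (leftX x′ j) a b)
      ∣Δx∣ false a b = trans (cong ∣_∣ (Δ- (rightX x″ j) a b)) (ℤP.∣i-j∣≡∣j-i∣ b a)
      placeX-injective : ∀ e {a b} → placeX e j a ≡ placeX e j b → a ≡ b
      placeX-injective true  eq = +-cancelˡ (leftX x′ j) eq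
      placeX-injective false eq = ℤP.neg-injective (+-cancelˡ (rightX x″ j) eq)

    private
      L+R-L≡R : ∀ L R → L + R - L ≡ R
      L+R-L≡R = solve-∀

      c≡L+[c-L] : ∀ c L → c ≡ L + (c - L)
      c≡L+[c-L] = solve-∀

      Y+1-Y≡1 : ∀ Y → Y + + 1 - Y ≡ + 1
      Y+1-Y≡1 = solve-∀

      leftX-even : ∀ j → isEven j ≡ true → leftX x′ j ≡ x′ + baseY j
      leftX-even j e rewrite e = refl

      rightX-odd : ∀ j → isEven j ≡ false → rightX x″ j ≡ x″ - baseY j + + 3
      rightX-odd j e rewrite e = refl

      place-even : ∀ j → isEven j ≡ true → ∀ a y → place j (a , y) ≡ (x′ + baseY j + a , baseY j + y)
      place-even j e a y = cong₂ _,_ (trans (cong (λ b → placeX b j a) e) (cong (_+ a) (leftX-even j e))) refl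

      place-odd : ∀ j → isEven j ≡ false → ∀ a y → place j (a , y) ≡ (x″ - baseY j + + 3 - a , baseY j + y)
      place-odd j e a y = cong₂ _,_ (trans (cong (λ b → placeX b j a) e) (cong (_- a) (rightX-odd j e))) refl

    place-flipUp : ∀ m j → suc m ℕ.+ j ≡ suc k₀ → ∀ u → place j (flipUp (width (suc m) g) u) ≡ place (suc j) u
    place-flipUp m j m+j≡ (a , y) = by-parity (isEven j) refl
      where
      R = width (suc m) g
      J = baseY j
      open ≡-Reasoning
      J+[y+4]≡J+4+y : ∀ J y → J + (y + + 4) ≡ J + + 4 + y
      J+[y+4]≡J+4+y = solve-∀
      by-parity : ∀ e → isEven j ≡ e → place j (flipUp R (a , y)) ≡ place (suc j) (a , y)
      by-parity true ej = begin
        place j (R - + 1 - a , y + + 4)                             ≡⟨ place-even j ej (R - + 1 - a) (y + + 4) ⟩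
        (x′ + J + (R - + 1 - a) , J + (y + + 4))                      ≡⟨ cong₂ _,_ (trans (x-via-x″ x′ J R a) (cong (λ z → z - (J + + 4) + + 3 - a) (sym (x″-split (suc m) j m+j≡))))
                                                                                  (J+[y+4]≡J+4+y J y) ⟩
        (x″ - (J + + 4) + + 3 - a , (J + + 4) + y)                    ≡⟨ cong (λ w → (x″ - w + + 3 - a , w + y)) (sym (baseY-suc j)) ⟩
        (x″ - baseY (suc j) + + 3 - a , baseY (suc j) + y)            ≡⟨ sym (place-odd (suc j) (trans (isEven-suc j) (cong not ej)) a y) ⟩
        place (suc j) (a , y)                                         ∎
        where
        x-via-x″ : ∀ x′ J R a → x′ + J + (R - + 1 - a) ≡ x′ + ((J + J) + R) - (J + + 4) + + 3 - a
        x-via-x″ = solve-∀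
      by-parity false ej = begin
        place j (R - + 1 - a , y + + 4)                             ≡⟨ place-odd j ej (R - + 1 - a) (y + + 4) ⟩
        (x″ - J + + 3 - (R - + 1 - a) , J + (y + + 4))                ≡⟨ cong₂ _,_ (trans (cong (λ z → z - J + + 3 - (R - + 1 - a)) (x″-split (suc m) j m+j≡)) (x-via-x′ x′ J R a))
                                                                                  (J+[y+4]≡J+4+y J y) ⟩
        (x′ + (J + + 4) + a , (J + + 4) + y)                          ≡⟨ cong (λ w → (x′ + w + a , w + y)) (sym (baseY-suc j)) ⟩
        (x′ + baseY (suc j) + a , baseY (suc j) + y)                  ≡⟨ sym (place-even (suc j) (trans (isEven-suc j) (cong not ej)) a y) ⟩
        place (suc j) (a , y)                                         ∎
        where
        x-via-x′ : ∀ x′ J R a → x′ + ((J + J) + R) - J + + 3 - (R - + 1 - a) ≡ x′ + (J + + 4) + a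
        x-via-x′ = solve-∀

    leftX+width≡rightX : ∀ m j → m ℕ.+ j ≡ suc k₀ → leftX x′ j + width m g ≡ rightX x″ j
    leftX+width≡rightX m j m+j≡ with isEven j
    ... | true  = trans (x′+J+R≡x′+[2J+R]-J x′ (baseY j) (width m g)) (cong (_- baseY j) (sym (x″-split m j m+j≡)))
      where
      x′+J+R≡x′+[2J+R]-J : ∀ x′ J R → x′ + J + R ≡ x′ + ((J + J) + R) - J
      x′+J+R≡x′+[2J+R]-J = solve-∀
    ... | false = trans (x′+J+3+R≡x′+[2J+R]-J+3 x′ (baseY j) (width m g)) (cong (λ z → z - baseY j + + 3) (sym (x″-split m j m+j≡)))
      where
      x′+J+3+R≡x′+[2J+R]-J+3 : ∀ x′ J R → x′ + J + + 3 + R ≡ x′ + ((J + J) + R) - J + + 3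
      x′+J+3+R≡x′+[2J+R]-J+3 = solve-∀

    private
      +-mono : ∀ L {a b} → a ≤ b → L + a ≤ L + b
      +-mono L = ℤP.+-monoʳ-≤ L
      sub-mono : ∀ L {a b} → a ≤ b → L - b ≤ L - a
      sub-mono L = ℤP.+-monoʳ-≤ L ∘ ℤP.neg-mono-≤

    place-twine⁺ : ∀ m j → m ℕ.+ j ≡ suc k₀ → ∀ u → InTwineFrame (width m g) u → InE x′ x″ j (place j u)
    place-twine⁺ m j m+j≡ (a , y) ((0≤a , a≤R) , (0≤y , y≤1)) = x-bounds (isEven j) , (y-low , +-mono (baseY j) y≤1)
      where
      L = leftX x′ j
      R = width m g
      L+R≡ : L + R ≡ rightX x″ j
      L+R≡ = leftX+width≡rightX m j m+j≡
      x-bounds : ∀ e → L ≤ placeX e j a × placeX e j a ≤ rightX x″ j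
      x-bounds true  = subst (_≤ L + a) (ℤP.+-identityʳ L) (+-mono L 0≤a) , subst (L + a ≤_) L+R≡ (+-mono L a≤R)
      x-bounds false = subst (_≤ _) (trans (cong (_- R) (sym L+R≡)) (L+R-R≡L L R)) (sub-mono (rightX x″ j) a≤R) ,
                       subst (rightX x″ j - a ≤_) (ℤP.+-identityʳ (rightX x″ j)) (sub-mono (rightX x″ j) 0≤a)
        where
        L+R-R≡L : ∀ L R → L + R - R ≡ L
        L+R-R≡L = solve-∀
      y-low : baseY j ≤ baseY j + y
      y-low = subst (_≤ baseY j + y) (ℤP.+-identityʳ (baseY j)) (+-mono (baseY j) 0≤y)

    place-twine⁻ : ∀ m j → m ℕ.+ j ≡ suc k₀ → ∀ c → InE x′ x″ j c → ∃ λ u → InTwineFrame (width m g) u × c ≡ place j u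
    place-twine⁻ m j m+j≡ (c₁ , c₂) ((L≤c₁ , c₁≤R′) , (Y≤c₂ , c₂≤Y+1)) = by-parity (isEven j) refl
      where
      L = leftX x′ j
      R = width m g
      R′ = rightX x″ j
      Y = baseY j
      L+R≡ : L + R ≡ rightX x″ j
      L+R≡ = leftX+width≡rightX m j m+j≡
      y-bounds : + 0 ≤ c₂ - Y × c₂ - Y ≤ + 1
      y-bounds = subst (_≤ c₂ - Y) (ℤP.+-inverseʳ Y) (ℤP.+-monoˡ-≤ (- Y) Y≤c₂) ,
                 subst (c₂ - Y ≤_) (Y+1-Y≡1 Y) (ℤP.+-monoˡ-≤ (- Y) c₂≤Y+1)
      c≡L-[L-c] : ∀ c L → c ≡ L - (L - c)
      c≡L-[L-c] = solve-∀
      by-parity : ∀ e → isEven j ≡ e → ∃ λ u → InTwineFrame R u × (c₁ , c₂) ≡ place j u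
      by-parity true ej = (c₁ - L , c₂ - Y) ,
        ((subst (_≤ c₁ - L) (ℤP.+-inverseʳ L) (ℤP.+-monoˡ-≤ (- L) L≤c₁) ,
          subst (c₁ - L ≤_) (trans (cong (_- L) (sym L+R≡)) (L+R-L≡R L R)) (ℤP.+-monoˡ-≤ (- L) c₁≤R′)) , y-bounds) ,
        cong₂ _,_ (trans (c≡L+[c-L] c₁ L) (cong (λ e → placeX e j (c₁ - L)) (sym ej))) (c≡L+[c-L] c₂ Y)
      by-parity false ej = (R′ - c₁ , c₂ - Y) ,
        ((subst (_≤ R′ - c₁) (ℤP.+-inverseʳ R′) (sub-mono R′ c₁≤R′) ,
          subst (R′ - c₁ ≤_) (trans (cong (_- L) (sym L+R≡)) (L+R-L≡R L R)) (sub-mono R′ L≤c₁)) , y-bounds) ,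
        cong₂ _,_ (trans (c≡L-[L-c] c₁ R′) (cong (λ e → placeX e j (R′ - c₁)) (sym ej))) (c≡L+[c-L] c₂ Y)

    place-right-even : ∀ m j → m ℕ.+ j ≡ suc k₀ → isEven j ≡ true → ∀ d →
                       place j (cellAt (width m g) (fromRight d)) ≡ lowerRight x″ j ⊕ d
    place-right-even m j m+j≡ ej (a , y) = cong₂ _,_
      (trans (cong (λ e → placeX e j (width m g + a)) ej)
        (trans (sym (ℤP.+-assoc (leftX x′ j) (width m g) a)) (cong (_+ a) (leftX+width≡rightX m j m+j≡)))) refl

    place-right-odd : ∀ m j → m ℕ.+ j ≡ suc k₀ → isEven j ≡ false → ∀ d →
                      place j (cellAt (width m g) (fromRight d)) ≡ lowerLeft x′ j ⊕ mirror d
    place-right-odd m j m+j≡ ej (a , y) = cong₂ _,_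
      (trans (cong (λ e → placeX e j (width m g + a)) ej)
        (trans (cong (λ z → z - (width m g + a)) (sym (leftX+width≡rightX m j m+j≡))) (L+R-[R+a]≡L-a (leftX x′ j) (width m g) a))) refl
      where
      L+R-[R+a]≡L-a : ∀ L R a → L + R - (R + a) ≡ L + - a
      L+R-[R+a]≡L-a = solve-∀

    InSplice : ℕ → Cell → Set
    InSplice i c = (isEven i ≡ true × InTranslate (lowerRight x″ i) spliceRightOffsets c)
                 ⊎ (isEven i ≡ false × InTranslate (lowerLeft x′ i) spliceLeftOffsets c)

    InTopTie : Cell → Set
    InTopTie c = (isEven k ≡ true × InTranslate (lowerLeft x′ (k ∸ 1)) tieLeftOffsets c)
               ⊎ (isEven k ≡ false × InTranslate (lowerRight x″ (k ∸ 1)) tieRightOffsets c)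

    splice⁺ : ∀ m j → m ℕ.+ j ≡ suc k₀ → ∀ {d} → d ∈ spliceRightOffsets →
              InSplice j (place j (cellAt (width m g) (fromRight d)))
    splice⁺ m j m+j≡ {d} d∈ = by-parity (isEven j) refl
      where
      by-parity : ∀ e → isEven j ≡ e → InSplice j (place j (cellAt (width m g) (fromRight d)))
      by-parity true  ej = inj₁ (ej , d , d∈ , place-right-even m j m+j≡ ej d)
      by-parity false ej = inj₂ (ej , mirror d , ∈-map⁺ mirror d∈ , place-right-odd m j m+j≡ ej d)

    splice⁻ : ∀ m j → m ℕ.+ j ≡ suc k₀ → ∀ {c} → InSplice j c →
              ∃ λ d → d ∈ spliceRightOffsets × c ≡ place j (cellAt (width m g) (fromRight d))
    splice⁻ m j m+j≡ (inj₁ (ej , d , d∈ , refl)) = d , d∈ , sym (place-right-even m j m+j≡ ej d)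
    splice⁻ m j m+j≡ (inj₂ (ej , _ , d∈ , refl)) with ∈-map⁻ mirror d∈
    ... | d , d∈′ , refl = d , d∈′ , sym (place-right-odd m j m+j≡ ej d)

    private
      isEven-k : isEven k ≡ not (isEven (suc k₀))
      isEven-k = isEven-suc (suc k₀)

      not-injective : ∀ {a b} → not a ≡ not b → a ≡ b
      not-injective {false} {false} _ = refl
      not-injective {true}  {true}  _ = refl

    topTie⁺ : ∀ {d} → d ∈ tieRightOffsets → InTopTie (place (suc k₀) (cellAt (width 0 g) (fromRight d)))
    topTie⁺ {d} d∈ = by-parity (isEven (suc k₀)) refl
      where
      by-parity : ∀ e → isEven (suc k₀) ≡ e → InTopTie (place (suc k₀) (cellAt (width 0 g) (fromRight d)))
      by-parity true  ej = inj₂ (trans isEven-k (cong not ej) , d , d∈ , place-right-even 0 (suc k₀) refl ej d)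
      by-parity false ej = inj₁ (trans isEven-k (cong not ej) , mirror d , ∈-map⁺ mirror d∈ , place-right-odd 0 (suc k₀) refl ej d)

    topTie⁻ : ∀ {c} → InTopTie c → ∃ λ d → d ∈ tieRightOffsets × c ≡ place (suc k₀) (cellAt (width 0 g) (fromRight d))
    topTie⁻ (inj₁ (ek , _ , d∈ , refl)) with ∈-map⁻ mirror d∈
    ... | d , d∈′ , refl = d , d∈′ , sym (place-right-odd 0 (suc k₀) refl (not-injective (trans (sym isEven-k) ek)) d)
    topTie⁻ (inj₂ (ek , d , d∈ , refl)) = d , d∈ , sym (place-right-even 0 (suc k₀) refl (not-injective (trans (sym isEven-k) ek)) d)

    InUₖ : Cell → Set
    InUₖ = InU k x′ x″

    private
      twine-in-U : ∀ {c} i → i < k → InE x′ x″ i c → InUₖ c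
      twine-in-U i i<k c∈ = inj₁ (i , i<k , c∈)

      splice-in-U : ∀ {c} i → suc i < k → InSplice i c → InUₖ c
      splice-in-U i i+1<k c∈ = inj₂ (inj₂ (inj₁ (i , i+1<k , c∈)))

      topTie-in-U : ∀ {c} → InTopTie c → InUₖ c
      topTie-in-U = inj₂ ∘ inj₂ ∘ inj₂

      bottomTie-in-U : ∀ {d} → d ∈ tieLeftOffsets → InUₖ (place 0 d)
      bottomTie-in-U d∈ = inj₂ (inj₁ (_ , d∈ , refl))

      j<k : ∀ m j → m ℕ.+ j ≡ suc k₀ → j < k
      j<k m j m+j≡ = s≤s (NP.≤-trans (NP.m≤n+m j m) (NP.≤-reflexive m+j≡))

      j+1<k : ∀ m j → suc m ℕ.+ j ≡ suc k₀ → suc j < k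
      j+1<k m j m+j≡ = s≤s (NP.≤-trans (s≤s (NP.m≤n+m j m)) (NP.≤-reflexive m+j≡))

      zigzags-in-frame : ∀ m {u} → InZigzags (halfWidth m g) u → InTwineFrame (width m g) u
      zigzags-in-frame m {u} zz = subst (λ R → InTwineFrame R u) (sym (width≡ m g)) (zigzags⊆twine _ zz)

      frame-in-zigzags : ∀ m {u} → InTwineFrame (width m g) u → InZigzags (halfWidth m g) u
      frame-in-zigzags m {u} fr = twine⊆zigzags _ (subst (λ R → InTwineFrame R u) (width≡ m g) fr)

      spliceTop∈ : (+ 0 , + 6) ∈ spliceRightOffsets
      spliceTop∈ = there (there (there (there (there (there (there (there (there (here refl)))))))))

      spliceTop-placed : ∀ m j → suc m ℕ.+ j ≡ suc k₀ →
        place j (cellAt (width (suc m) g) (fromRight (+ 0 , + 6))) ≡ place (suc j) (cellAt (+ 0) lowerSpliceTop)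
      spliceTop-placed m j m+j≡ =
        trans (cong (place j) (flipUp-spliceTop (width (suc m) g))) (place-flipUp m j m+j≡ (cellAt (+ 0) lowerSpliceTop))
        where
        R-1+1≡R+0 : ∀ R → R - + 1 - (- + 1) ≡ R + + 0
        R-1+1≡R+0 = solve-∀
        flipUp-spliceTop : ∀ R → cellAt R (fromRight (+ 0 , + 6)) ≡ flipUp R (cellAt (+ 0) lowerSpliceTop)
        flipUp-spliceTop R = cong (_, + 6) (sym (R-1+1≡R+0 R))

      spliceTop-in-U : ∀ m j → m ℕ.+ suc j ≡ suc k₀ → InUₖ (place (suc j) (cellAt (+ 0) lowerSpliceTop))
      spliceTop-in-U m j m+j≡ = splice-in-U j (j+1<k m j m+j≡′)
        (subst (InSplice j) (spliceTop-placed m j m+j≡′) (splice⁺ (suc m) j m+j≡′ spliceTop∈))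
        where
        m+j≡′ : suc m ℕ.+ j ≡ suc k₀
        m+j≡′ = trans (sym (NP.+-suc m j)) m+j≡

      lift : ∀ m j → suc m ℕ.+ j ≡ suc k₀ → ∀ {h Q ℓ} → T (any hasUpperᵇ ℓ) → ∀ {c} →
             c ∈ map (place (suc j)) Q → c ∈ map (place j) (pieces (width (suc m) g) h Q ℓ)
      lift m j m+j≡ {ℓ = ℓ} t c∈ with ∈-map⁻ (place (suc j)) c∈
      ... | q , q∈ , refl = subst (_∈ _) (place-flipUp m j m+j≡ q)
                              (∈-map⁺ (place j) (upper⊆pieces ℓ t (AnyP.reverse⁺ (∈-map⁺ (flipUp (width (suc m) g)) q∈))))

      ∈-placed : ∀ j {L u c} → u ∈ L → c ≡ place j u → c ∈ map (place j) L
      ∈-placed j u∈ refl = ∈-map⁺ (place j) u∈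

      ≤⇒≡⊎< : ∀ {a b} → a ℕ.≤ b → a ≡ b ⊎ suc a ℕ.≤ b
      ≤⇒≡⊎< {a} {b} a≤b with a ℕ.≟ b
      ... | yes a≡b = inj₁ a≡b
      ... | no  a≢b = inj₂ (NP.≤∧≢⇒< a≤b a≢b)

    level-sound : ∀ p m j → m ℕ.+ suc j ≡ suc k₀ → ∀ {u} → u ∈ level p m g → InUₖ (place (suc j) u)
    level-sound p zero j m+j≡ u∈
      with ∈-pieces-cases _ (topLayout p) (LayoutChecks.singles-within (TopChecks.layout (top-checks p))) u∈
    ... | inj₁ zz = twine-in-U (suc j) (j<k 0 (suc j) m+j≡) (place-twine⁺ 0 (suc j) m+j≡ _ (zigzags-in-frame 0 zz))
    ... | inj₂ (inj₁ (q , q∈ , refl)) with ∈-++⁻ (map fromRight tieRightOffsets) q∈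
    ...   | inj₂ (here refl) = spliceTop-in-U 0 j m+j≡
    ...   | inj₁ q∈ties with ∈-map⁻ fromRight q∈ties | m+j≡
    ...     | d , d∈ , refl | refl = topTie-in-U (topTie⁺ d∈)
    level-sound p (suc m) j m+j≡ u∈
      with ∈-pieces-cases _ (middleLayout p) (LayoutChecks.singles-within (MiddleChecks.layout (middle-checks p))) u∈
    ... | inj₁ zz = twine-in-U (suc j) (j<k (suc m) (suc j) m+j≡)
                      (place-twine⁺ (suc m) (suc j) m+j≡ _ (zigzags-in-frame (suc m) zz))
    ... | inj₂ (inj₂ u∈upper) with ∈-map⁻ (flipUp (width (suc m) g)) (AnyP.reverse⁻ u∈upper)
    ...   | q , q∈ , refl = subst InUₖ (sym (place-flipUp m (suc j) m+j≡ q))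
                              (level-sound p m (suc j) (trans (NP.+-suc m (suc j)) m+j≡) q∈)
    level-sound p (suc m) j m+j≡ u∈ | inj₂ (inj₁ (q , q∈ , refl)) with ∈-++⁻ (map fromRight spliceRightOffsets) q∈
    ... | inj₂ (here refl) = spliceTop-in-U (suc m) j m+j≡
    ... | inj₁ q∈splices with ∈-map⁻ fromRight q∈splices
    ...   | d , d∈ , refl = splice-in-U (suc j) (j+1<k m (suc j) m+j≡) (splice⁺ (suc m) (suc j) m+j≡ d∈)

    Above : ℕ → Cell → Set
    Above j c = (∃ λ i → j ℕ.≤ i × i < k × InE x′ x″ i c)
              ⊎ (∃ λ i → j ℕ.≤ i × suc i < k × InSplice i c)
              ⊎ InTopTie c
              ⊎ c ≡ place j (cellAt (+ 0) lowerSpliceTop)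

    level-complete : ∀ p m j → m ℕ.+ suc j ≡ suc k₀ → ∀ {c} → Above (suc j) c → c ∈ map (place (suc j)) (level p m g)
    level-complete p zero .k₀ refl (inj₁ (i , k₀<i , i<k , c∈)) with NP.≤-antisym k₀<i (NP.≤-pred i<k)
    ... | refl with place-twine⁻ 0 (suc k₀) refl _ c∈
    ...   | u , u∈ , c≡ = ∈-placed (suc k₀) (zigzags⊆pieces (topLayout p)
                            (LayoutChecks.runs-present (TopChecks.layout (top-checks p))) (frame-in-zigzags 0 u∈)) c≡
    level-complete p zero .k₀ refl (inj₂ (inj₁ (i , k₀<i , s≤s (s≤s i<k₀) , _))) =
      ⊥-elim (NP.<-irrefl refl (NP.≤-trans k₀<i i<k₀))
    level-complete p zero .k₀ refl (inj₂ (inj₂ (inj₁ t))) with topTie⁻ t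
    ... | d , d∈ , c≡ with offset∈pieces fromRight nothing tieRightOffsets (topLayout p) (TopChecks.ties-present (top-checks p)) d∈
    ...   | inj₂ d∈pieces = ∈-placed (suc k₀) d∈pieces c≡
    level-complete p zero .k₀ refl (inj₂ (inj₂ (inj₂ refl))) =
      ∈-placed (suc k₀) (single∈pieces (topLayout p) lowerSpliceTop (TopChecks.top-present (top-checks p))) refl
    level-complete p (suc m) j m+j≡ above = by-cases above
      where
      checks : MiddleChecks (middleLayout p)
      checks = middle-checks p
      m+j≡′ : m ℕ.+ suc (suc j) ≡ suc k₀
      m+j≡′ = trans (NP.+-suc m (suc j)) m+j≡
      IH : ∀ {c} → Above (suc (suc j)) c → c ∈ map (place (suc (suc j))) (level p m g)
      IH = level-complete p m (suc j) m+j≡′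
      lift′ : ∀ {c} → c ∈ map (place (suc (suc j))) (level p m g) → c ∈ map (place (suc j)) (level p (suc m) g)
      lift′ = lift m (suc j) m+j≡ {halfWidth (suc m) g} {level p m g} {middleLayout p} (MiddleChecks.upper-present checks)
      by-cases : ∀ {c} → Above (suc j) c → c ∈ map (place (suc j)) (level p (suc m) g)
      by-cases (inj₁ (i , j<i , i<k , c∈)) with ≤⇒≡⊎< j<i
      ... | inj₂ j+1<i = lift′ (IH (inj₁ (i , j+1<i , i<k , c∈)))
      ... | inj₁ refl with place-twine⁻ (suc m) (suc j) m+j≡ _ c∈
      ...   | u , u∈ , c≡ = ∈-placed (suc j) (zigzags⊆pieces (middleLayout p)
                              (LayoutChecks.runs-present (MiddleChecks.layout checks)) (frame-in-zigzags (suc m) u∈)) c≡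
      by-cases (inj₂ (inj₁ (i , j<i , i+1<k , c∈))) with ≤⇒≡⊎< j<i
      ... | inj₂ j+1<i = lift′ (IH (inj₂ (inj₁ (i , j+1<i , i+1<k , c∈))))
      ... | inj₁ refl with splice⁻ (suc m) (suc j) m+j≡ c∈
      ...   | d , d∈ , c≡ with offset∈pieces fromRight (just (+ 0 , + 6)) spliceRightOffsets (middleLayout p)
                                 (MiddleChecks.splices-present checks) d∈
      ...     | inj₂ d∈pieces = ∈-placed (suc j) d∈pieces c≡
      ...     | inj₁ refl = lift′ (subst (_∈ _) (sym (trans c≡ (spliceTop-placed m (suc j) m+j≡))) (IH (inj₂ (inj₂ (inj₂ refl)))))
      by-cases (inj₂ (inj₂ (inj₁ t))) = lift′ (IH (inj₂ (inj₂ (inj₁ t))))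
      by-cases (inj₂ (inj₂ (inj₂ refl))) =
        ∈-placed (suc j) (single∈pieces (middleLayout p) lowerSpliceTop (MiddleChecks.top-present checks)) refl

    bottom : Bool → List Cell
    bottom p = cellAt (width (suc k₀) g) (bottomApex p) ∷ bottomCells p k₀ g

    private
      k₀+0≡ : suc k₀ ℕ.+ 0 ≡ suc k₀
      k₀+0≡ = NP.+-identityʳ (suc k₀)

      k₀+1≡ : k₀ ℕ.+ 1 ≡ suc k₀
      k₀+1≡ = NP.+-comm k₀ 1

      apex-offset : ∀ p → cellAt (width (suc k₀) g) (bottomApex p) ≡ bottomApexOffset p
      apex-offset true  = refl
      apex-offset false = refl

    bottom-sound : ∀ p {u} → u ∈ bottom p → InUₖ (place 0 u)
    bottom-sound true  (here refl) = bottomTie-in-U (here refl)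
    bottom-sound false (here refl) = bottomTie-in-U (there (there (here refl)))
    bottom-sound p (there u∈)
      with ∈-pieces-cases _ (bottomLayout p) (LayoutChecks.singles-within (BottomChecks.layout (bottom-checks p))) u∈
    ... | inj₁ zz = twine-in-U 0 (s≤s z≤n) (place-twine⁺ (suc k₀) 0 k₀+0≡ _ (zigzags-in-frame (suc k₀) zz))
    ... | inj₂ (inj₂ u∈upper) with ∈-map⁻ (flipUp (width (suc k₀) g)) (AnyP.reverse⁻ u∈upper)
    ...   | q , q∈ , refl = subst InUₖ (sym (place-flipUp k₀ 0 k₀+0≡ q)) (level-sound p k₀ 0 k₀+1≡ q∈)
    bottom-sound p (there u∈) | inj₂ (inj₁ (q , q∈ , refl)) with ∈-++⁻ (map fromRight spliceRightOffsets) q∈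
    ... | inj₁ q∈splices with ∈-map⁻ fromRight q∈splices
    ...   | d , d∈ , refl = splice-in-U 0 (s≤s (s≤s z≤n)) (splice⁺ (suc k₀) 0 k₀+0≡ d∈)
    bottom-sound p (there u∈) | inj₂ (inj₁ (q , q∈ , refl)) | inj₂ q∈ties with ∈-map⁻ fromLeft q∈ties
    ... | d , d∈ , refl = bottomTie-in-U d∈

    bottom-complete : ∀ p {c} → InUₖ c → c ∈ map (place 0) (bottom p)
    bottom-complete p = by-cases
      where
      checks : BottomChecks (bottomApexOffset p) (bottomLayout p)
      checks = bottom-checks p
      IH : ∀ {c} → Above 1 c → c ∈ map (place 1) (level p k₀ g)
      IH = level-complete p k₀ 0 k₀+1≡
      lift′ : ∀ {c} → c ∈ map (place 1) (level p k₀ g) → c ∈ map (place 0) (bottom p)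
      lift′ = there ∘ lift k₀ 0 k₀+0≡ {halfWidth (suc k₀) g} {level p k₀ g} {bottomLayout p} (BottomChecks.upper-present checks)
      in-pieces : ∀ {u c} → u ∈ bottomCells p k₀ g → c ≡ place 0 u → c ∈ map (place 0) (bottom p)
      in-pieces u∈ c≡ = ∈-placed 0 {bottom p} (there u∈) c≡
      by-cases : ∀ {c} → InUₖ c → c ∈ map (place 0) (bottom p)
      by-cases (inj₁ (zero , _ , c∈)) with place-twine⁻ (suc k₀) 0 k₀+0≡ _ c∈
      ... | u , u∈ , c≡ = in-pieces (zigzags⊆pieces (bottomLayout p)
                            (LayoutChecks.runs-present (BottomChecks.layout checks)) (frame-in-zigzags (suc k₀) u∈)) c≡
      by-cases (inj₁ (suc i , i<k , c∈)) = lift′ (IH (inj₁ (suc i , s≤s z≤n , i<k , c∈)))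
      by-cases (inj₂ (inj₁ (d , d∈ , refl)))
        with offset∈pieces fromLeft (just (bottomApexOffset p)) tieLeftOffsets (bottomLayout p) (BottomChecks.ties-present checks) d∈
      ... | inj₁ refl = here (cong (place 0) (sym (apex-offset p)))
      ... | inj₂ d∈pieces = in-pieces d∈pieces refl
      by-cases (inj₂ (inj₂ (inj₁ (zero , _ , c∈)))) with splice⁻ (suc k₀) 0 k₀+0≡ c∈
      ... | d , d∈ , c≡ with offset∈pieces fromRight (just (+ 0 , + 6)) spliceRightOffsets (bottomLayout p)
                               (BottomChecks.splices-present checks) d∈
      ...   | inj₂ d∈pieces = in-pieces d∈pieces c≡
      ...   | inj₁ refl = lift′ (subst (_∈ _) (sym (trans c≡ (spliceTop-placed k₀ 0 k₀+0≡))) (IH (inj₂ (inj₂ (inj₂ refl)))))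
      by-cases (inj₂ (inj₂ (inj₁ (suc i , i+1<k , c∈)))) = lift′ (IH (inj₂ (inj₁ (suc i , s≤s z≤n , i+1<k , c∈))))
      by-cases (inj₂ (inj₂ (inj₂ t))) = lift′ (IH (inj₂ (inj₂ (inj₁ t))))

    U⇔bottom : ∀ p c → InUₖ c ⇔ c ∈ map (place 0) (bottom p)
    U⇔bottom p c = mk⇔ (bottom-complete p) λ c∈ → case ∈-map⁻ (place 0) c∈ of λ { (u , u∈ , refl) → bottom-sound p u∈ }

  U-isCycle : ∀ k₀ g₁ x′ x″ → x″ ≡ x′ + + (2 ℕ.* halfWidth (suc k₀) (suc g₁)) → KnightGraphIsCycle (InU (suc (suc k₀)) x′ x″)
  U-isCycle k₀ g₁ x′ x″ x″≡ with bottom-cycle (odd (suc g₁)) k₀ (suc g₁) refl (s≤s z≤n)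
  ... | _ , _ , C = isCycle-resp-⇔ (U⇔bottom (odd (suc g₁))) (inducedCycle⇒isCycle (map-cycle (place-isometry 0) C))
    where open Placement k₀ g₁ x′ x″ x″≡

  private
    nonnegative : ∀ {d} → + 1 ≤ d → ∃ λ n → d ≡ + n
    nonnegative {+ n} _ = n , refl

  -- An odd width 2t + 1 ≥ 8k − 5 leaves a top twine of half-width t − 4(k − 1) ≥ 1.
  odd-width⇒halfWidth : ∀ k₀ {x′ x″} → + (8 ℕ.* suc (suc k₀) ∸ 5) ≤ (x″ - x′) + + 1 → ¬ (+ 2 ∣ (x″ - x′) + + 1) →
                        ∃ λ g₁ → x″ ≡ x′ + + (2 ℕ.* halfWidth (suc k₀) (suc g₁))
  odd-width⇒halfWidth k₀ {x′} {x″} wide odd-width = decompose (nonnegative (ℤP.≤-trans (+≤+ (s≤s z≤n)) wide′))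
    where
    8[2+k]-5≡ : 8 ℕ.* suc (suc k₀) ∸ 5 ≡ 11 ℕ.+ 8 ℕ.* k₀
    8[2+k]-5≡ = trans (cong (_∸ 5) (8[2+k]≡5+[11+8k] k₀)) (NP.m+n∸m≡n 5 (11 ℕ.+ 8 ℕ.* k₀))
      where
      8[2+k]≡5+[11+8k] : ∀ k → 8 ℕ.* suc (suc k) ≡ 5 ℕ.+ (11 ℕ.+ 8 ℕ.* k)
      8[2+k]≡5+[11+8k] = NS.solve-∀
    wide′ : + (11 ℕ.+ 8 ℕ.* k₀) ≤ (x″ - x′) + + 1
    wide′ = subst (λ n → + n ≤ (x″ - x′) + + 1) 8[2+k]-5≡ wide
    decompose : (∃ λ n → (x″ - x′) + + 1 ≡ + n) → ∃ λ g₁ → x″ ≡ x′ + + (2 ℕ.* halfWidth (suc k₀) (suc g₁))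
    decompose (n , D≡n) with bit+2*-surjective n
    ... | false , t , refl = ⊥-elim (odd-width (subst (+ 2 ∣_) (sym D≡n) (divides t (NP.*-comm 2 t))))
    ... | true  , t , refl = g₁ , x″≡
      where
      11+8k≤1+2t : 11 ℕ.+ 8 ℕ.* k₀ ℕ.≤ 1 ℕ.+ 2 ℕ.* t
      11+8k≤1+2t with subst (+ (11 ℕ.+ 8 ℕ.* k₀) ≤_) D≡n wide′
      ... | +≤+ le = le
      5+4k≤t : 4 ℕ.+ 4 ℕ.* k₀ ℕ.+ 1 ℕ.≤ t
      5+4k≤t = NP.*-cancelˡ-≤ 2 (NP.+-cancelˡ-≤ 1 _ _ (NP.≤-trans (NP.≤-reflexive (1+2[5+4k]≡11+8k k₀)) 11+8k≤1+2t))
        where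
        1+2[5+4k]≡11+8k : ∀ k → 1 ℕ.+ 2 ℕ.* (4 ℕ.+ 4 ℕ.* k ℕ.+ 1) ≡ 11 ℕ.+ 8 ℕ.* k
        1+2[5+4k]≡11+8k = NS.solve-∀
      g₁ : ℕ
      g₁ = t ∸ (4 ℕ.+ 4 ℕ.* k₀ ℕ.+ 1)
      halfWidth≡t : halfWidth (suc k₀) (suc g₁) ≡ t
      halfWidth≡t = trans (halfWidth≡ (suc k₀) (suc g₁)) (trans (4[1+k]+[1+g]≡[5+4k]+g k₀ g₁) (NP.m+[n∸m]≡n 5+4k≤t))
        where
        4[1+k]+[1+g]≡[5+4k]+g : ∀ k g → 4 ℕ.* suc k ℕ.+ suc g ≡ (4 ℕ.+ 4 ℕ.* k ℕ.+ 1) ℕ.+ g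
        4[1+k]+[1+g]≡[5+4k]+g = NS.solve-∀
      x″≡ : x″ ≡ x′ + + (2 ℕ.* halfWidth (suc k₀) (suc g₁))
      x″≡ = trans (b≡a+[[b-a+1]-1] x′ x″) (cong (λ z → x′ + (z - + 1)) (trans D≡n (cong (λ h → + (1 ℕ.+ 2 ℕ.* h)) (sym halfWidth≡t))))
        where
        b≡a+[[b-a+1]-1] : ∀ a b → b ≡ a + ((b - a + + 1) - + 1)
        b≡a+[[b-a+1]-1] = solve-∀

open import Defs
open import Data.Nat using (ℕ; _≤_; _*_; _∸_; suc; s≤s; z≤n)
open import Data.Integer using (ℤ; +_; _+_; _-_)
open import Data.Integer.Divisibility using (_∣_)
open import Relation.Nullary using (¬_)
open import Data.Product using (_,_)
open KnightCycle using (odd-width⇒halfWidth; U-isCycle)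

lemma8 : (k : ℕ) → 2 ≤ k → (x′ x″ : ℤ) →
    + (8 * k ∸ 5) Data.Integer.≤ (x″ - x′) + + 1 →
    ¬ (+ 2 ∣ (x″ - x′) + + 1) →
    KnightGraphIsCycle (InU k x′ x″)
lemma8 (suc (suc k₀)) (s≤s (s≤s z≤n)) x′ x″ wide odd-width with odd-width⇒halfWidth k₀ wide odd-width
... | g₁ , x″≡ = U-isCycle k₀ g₁ x′ x″ x″≡
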